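{- The basis $\{X_\alpha\}$ defined by $X_\alpha = \sum_{\beta \ge \alpha} f(\alpha, \beta) M_\beta$, where \[ f(\alpha) = \begin{cases} f_\mathbb{E}(\alpha|_\mathbb{E}) \frac{1}{\mathrm{odd}(\alpha)!} & \text{if } \alpha = \alpha|_\mathbb{E} \, \alpha|_\mathbb{O}, \\ 0 & \text{otherwise,} \end{cases} \] is an eigenbasis for $\Theta,$ with \[ \Theta(X_\alpha) = \begin{cases} 2^{\ell(\alpha)} X_\alpha & \text{if } \alpha \text{ is odd}, \\ 0 & \text{otherwise.} \end{cases} \]
   Context: Work over a field $\mathbbm{k}$ of characteristic zero. Compositions are finite sequences of positive integers; a composition is odd if all its parts are odd; $\mathrm{odd}(\alpha)$ is its number of odd parts. $\mathbb{E}=\{2,4,6,\dots\}$, $\mathbb{O}=\{1,3,5,\dots\}$, and $\alpha|_C$ is the subsequence of parts of $\alpha$ in $C$. For $\alpha\le\beta$ (i.e. $\alpha=\alpha^{(1)}\cdots\alpha^{(\ell(\beta))}$ with $\alpha^{(i)}$ a composition of $\beta_i$), $f(\alpha,\beta)=\prod_i f(\alpha^{(i)})$. $\{M_\alpha\}$ is the monomial basis of $\mathrm{QSym}$. Here $f_\mathbb{E}$ is any nonsingular shuffle character, i.e. $f_\mathbb{E}(n)\neq0$ for all $n$ and, setting $f_\mathbb{E}(\emptyset)=1$, $f_\mathbb{E}(\alpha)f_\mathbb{E}(\beta)=\sum_{\gamma\in\alpha \sqcup\!\sqcup \beta}f_\mathbb{E}(\gamma)$, where $\alpha \sqcup\!\sqcup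 \beta$ is the multiset of compositions of length $\ell(\alpha)+\ell(\beta)$ containing $\alpha,\beta$ as disjoint subsequences, with multiplicity (so that $\{X_\alpha\}$ is a shuffle basis). Let $\zeta_Q$ be the character of $\mathrm{QSym}$ with $\zeta_Q(F)=F(1,0,0,\dots)$, $\overline{\zeta}_Q(M_\alpha)=(-1)^{|\alpha|}\zeta_Q(M_\alpha)$, and $\nu_Q=\overline{\zeta}_Q^{ -1}*\zeta_Q$ (convolution). $\Theta\colon\mathrm{QSym}\to\mathrm{QSym}$ is the unique Hopf map with $\zeta_Q\circ\Theta=\nu_Q$ (morphism of combinatorial Hopf algebras $(\mathrm{QSym},\nu_Q)\to(\mathrm{QSym},\zeta_Q)$). -}

module Defs where

open import Level using (Level; _⊔_) renaming (suc to lsuc)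
open import Algebra.Bundles using (CommutativeRing)
open import Data.Bool using (Bool; true; false; if_then_else_; not)
open import Data.Nat as ℕ using (ℕ; zero; suc; _!; _^_)
open import Data.List using (List; []; _∷_; [_]; _++_; map; concatMap; foldr; length; filterᵇ)
open import Data.List.NonEmpty as L⁺ using (List⁺; _∷_)
open import Data.List.Properties using (≡-dec)
open import Data.Product using (_×_; _,_)
open import Relation.Nullary using (¬_; yes; no; Dec)
open import Relation.Nullary.Decidable using (⌊_⌋; map′)
open import Relation.Binary.PropositionalEquality using (_≡_; refl; cong)

-- a positive integer, 1+ k stands for k+1
record ℕ⁺ : Set where
  constructor 1+
  field pred : ℕ

val : ℕ⁺ → ℕ
val (1+ k) = suc k

_≟⁺_ : (p q : ℕ⁺) → Dec (p ≡ q)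
1+ a ≟⁺ 1+ b = map′ (cong 1+) (λ { refl → refl }) (a ℕ.≟ b)

_⊕_ : ℕ⁺ → ℕ⁺ → ℕ⁺
1+ a ⊕ 1+ b = 1+ (suc (a ℕ.+ b))

Comp : Set
Comp = List ℕ⁺

_≟C_ : (α β : Comp) → Dec (α ≡ β)
_≟C_ = ≡-dec _≟⁺_

size : Comp → ℕ
size α = foldr ℕ._+_ 0 (map val α)

evenᵇ : ℕ → Bool
evenᵇ zero = true
evenᵇ (suc n) = not (evenᵇ n)

isEvenPart : ℕ⁺ → Bool
isEvenPart p = evenᵇ (val p)

isOddPart : ℕ⁺ → Bool
isOddPart p = not (isEvenPart p)

restrictE : Comp → Comp
restrictE = filterᵇ isEvenPart

restrictO : Comp → Comp
restrictO = filterᵇ isOddPart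

oddCount : Comp → ℕ
oddCount α = length (restrictO α)

isOddComp : Comp → Bool
isOddComp [] = true
isOddComp (a ∷ α) = if isOddPart a then isOddComp α else false

decon : Comp → List (Comp × Comp)
decon [] = ([] , []) ∷ []
decon (a ∷ α) = ([] , a ∷ α) ∷ map (λ { (p , s) → (a ∷ p , s) }) (decon α)

shuffle : Comp → Comp → List Comp
shuffle [] β = [ β ]
shuffle (a ∷ α) [] = [ a ∷ α ]
shuffle (a ∷ α) (b ∷ β) =
  map (a ∷_) (shuffle α (b ∷ β)) ++ map (b ∷_) (shuffle (a ∷ α) β)

-- quasi-shuffles (multiset), giving the product M_α M_β = Σ M_γ
quasiShuffle : Comp → Comp → List Comp
quasiShuffle [] β = [ β ]
quasiShuffle (a ∷ α) [] = [ a ∷ α ]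
quasiShuffle (a ∷ α) (b ∷ β) =
  map (a ∷_) (quasiShuffle α (b ∷ β))
  ++ map (b ∷_) (quasiShuffle (a ∷ α) β)
  ++ map ((a ⊕ b) ∷_) (quasiShuffle α β)

-- decompositions α = α⁽¹⁾ ⋯ α⁽ᵏ⁾ into consecutive nonempty blocks;
-- these are in bijection with the β ≥ α (β_i = |α⁽ⁱ⁾|)
private
  extend : ℕ⁺ → List (List⁺ ℕ⁺) → List (List (List⁺ ℕ⁺))
  extend a [] = [ (a ∷ []) ∷ [] ]
  extend a (b ∷ bs) = ((a ∷ []) ∷ b ∷ bs) ∷ ((a L⁺.∷⁺ b) ∷ bs) ∷ []

blockDecomps : Comp → List (List (List⁺ ℕ⁺))
blockDecomps [] = [ [] ]
blockDecomps (a ∷ α) = concatMap (extend a) (blockDecomps α)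

blockSum : List⁺ ℕ⁺ → ℕ⁺
blockSum = L⁺.foldr₁ _⊕_

record Field (c ℓ : Level) : Set (lsuc (c ⊔ ℓ)) where
  field
    commutativeRing : CommutativeRing c ℓ
  open CommutativeRing commutativeRing public
  field
    _⁻¹ : Carrier → Carrier
    1≉0 : ¬ (1# ≈ 0#)
    ⁻¹-inverse : ∀ x → ¬ (x ≈ 0#) → x * (x ⁻¹) ≈ 1#

module Over {c ℓ} (𝕜 : Field c ℓ) where
  open Field 𝕜

  ι : ℕ → Carrier
  ι zero = 0#
  ι (suc n) = 1# + ι n

  CharZero : Set ℓ
  CharZero = ∀ n → ¬ (ι (suc n) ≈ 0#)

  sumK : List Carrier → Carrier
  sumK = foldr _+_ 0#

  prodK : List Carrier → Carrier
  prodK = foldr _*_ 1#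

  minus1^ : ℕ → Carrier
  minus1^ zero = 1#
  minus1^ (suc n) = - minus1^ n

  pow : Carrier → ℕ → Carrier
  pow x zero = 1#
  pow x (suc n) = x * pow x n

  -- QSym: elements are finite formal sums Σ c_γ M_γ
  QSym : Set c
  QSym = List (Carrier × Comp)

  coeff : QSym → Comp → Carrier
  coeff x γ = sumK (map (λ { (a , δ) → if ⌊ δ ≟C γ ⌋ then a else 0# }) x)

  _≃_ : QSym → QSym → Set ℓ
  x ≃ y = ∀ γ → coeff x γ ≈ coeff y γ

  M : Comp → QSym
  M α = [ (1# , α) ]

  zeroQ : QSym
  zeroQ = []

  scale : Carrier → QSym → QSym
  scale a = map (λ { (b , γ) → (a * b , γ) })

  mulQ : QSym → QSym → QSym
  mulQ x y = concatMap (λ { (a , β) → concatMap (λ { (b , γ) →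
               map (λ δ → (a * b , δ)) (quasiShuffle β γ) }) y }) x

  -- QSym ⊗ QSym, basis M_β ⊗ M_γ
  QSym⊗QSym : Set c
  QSym⊗QSym = List (Carrier × Comp × Comp)

  coeff₂ : QSym⊗QSym → Comp → Comp → Carrier
  coeff₂ x β γ = sumK (map (λ { (a , δ , ε) →
    if ⌊ δ ≟C β ⌋ then (if ⌊ ε ≟C γ ⌋ then a else 0#) else 0# }) x)

  _≃₂_ : QSym⊗QSym → QSym⊗QSym → Set ℓ
  x ≃₂ y = ∀ β γ → coeff₂ x β γ ≈ coeff₂ y β γ

  Δ : QSym → QSym⊗QSym
  Δ x = concatMap (λ { (a , γ) → map (λ { (p , s) → (a , p , s) }) (decon γ) }) x

  counit : QSym → Carrier
  counit x = coeff x []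

  linExt : (Comp → QSym) → QSym → QSym
  linExt θ x = concatMap (λ { (a , γ) → scale a (θ γ) }) x

  linExt₂ : (Comp → QSym) → QSym⊗QSym → QSym⊗QSym
  linExt₂ θ x = concatMap (λ { (a , p , s) → concatMap (λ { (b , β) →
      map (λ { (d , δ) → (a * b * d , β , δ) }) (θ s) }) (θ p) }) x

  linFun : (Comp → Carrier) → QSym → Carrier
  linFun φ x = sumK (map (λ { (a , γ) → a * φ γ }) x)

  -- the linear map Θ with Θ(M_γ) = θ γ is a morphism of graded Hopf algebras
  record IsGradedHopfMap (θ : Comp → QSym) : Set (c ⊔ ℓ) where
    field
      graded : ∀ γ δ → ¬ (size δ ≡ size γ) → coeff (θ γ) δ ≈ 0#
      unit   : linExt θ (M []) ≃ M []
      mult   : ∀ β γ → linExt θ (mulQ (M β) (M γ)) ≃ mulQ (θ β) (θ γ)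
      comult : ∀ γ → Δ (linExt θ (M γ)) ≃₂ linExt₂ θ (Δ (M γ))
      counitPres : ∀ γ → counit (linExt θ (M γ)) ≈ counit (M γ)

  -- evaluation of M_α at finitely many variables x₁,…,xₙ (others 0):
  -- M_α(x) = Σ_{i₁<⋯<i_ℓ} x_{i₁}^{α₁} ⋯ x_{i_ℓ}^{α_ℓ}
  evalM : List Carrier → Comp → Carrier
  evalM xs [] = 1#
  evalM [] (a ∷ α) = 0#
  evalM (x ∷ xs) (a ∷ α) = pow x (val a) * evalM xs α + evalM xs (a ∷ α)

  ζQ : Comp → Carrier
  ζQ α = evalM (1# ∷ []) α

  ζQbar : Comp → Carrier
  ζQbar α = minus1^ (size α) * ζQ α

  conv : (Comp → Carrier) → (Comp → Carrier) → Comp → Carrier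
  conv φ ψ α = sumK (map (λ { (p , s) → φ p * ψ s }) (decon α))

  -- convolution inverse of φ (assuming φ(M_∅) = 1), computed by the
  -- recursion φ * φ⁻¹ = ε; the ℕ argument is fuel (≥ length)
  convInvAux : ℕ → (Comp → Carrier) → Comp → Carrier
  convInvAux _ φ [] = 1#
  convInvAux zero φ (a ∷ α) = 0#
  convInvAux (suc n) φ (a ∷ α) =
    - sumK (map (λ { (p , s) → φ (a ∷ p) * convInvAux n φ s }) (decon α))

  convInv : (Comp → Carrier) → Comp → Carrier
  convInv φ α = convInvAux (length α) φ α

  νQ : Comp → Carrier
  νQ = conv (convInv ζQbar) ζQ

  record IsNonsingularShuffleChar (fE : Comp → Carrier) : Set (c ⊔ ℓ) where
    field
      empty       : fE [] ≈ 1#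
      shuffleMult : ∀ α β → fE α * fE β ≈ sumK (map fE (shuffle α β))
      nonsingular : ∀ n → ¬ (fE [ n ] ≈ 0#)

  module _ (fE : Comp → Carrier) where
    fX : Comp → Carrier
    fX α = if ⌊ α ≟C (restrictE α ++ restrictO α) ⌋
             then fE (restrictE α) * (ι (oddCount α !) ⁻¹)
             else 0#

    X : Comp → QSym
    X α = map (λ bs → (prodK (map (λ b → fX (L⁺.toList b)) bs) , map blockSum bs))
              (blockDecomps α)

    eigenRHS : Comp → QSym
    eigenRHS α = if isOddComp α then scale (ι (2 ^ length α)) (X α) else zeroQ

{-# OPTIONS --safe #-}
-- For a linear functional χ on QSym write χ(X_α) = Σ_{β ≥ α} f(α,β) χ(M_β).  Since f(α,β) is a
-- product over the blocks of α, χ ↦ χ(X_·) sends the convolution of functionals (dual to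
-- deconcatenation) to convolution of functions on compositions.  By the coproduct condition the
-- coefficient of M_{aδ} in Θ(M_γ) is the convolution of the coefficients of M_(a) and of M_δ, so by
-- induction on δ it suffices to know the coefficient of M_(a) in Θ(X_α).  As Θ is graded and ζ_Q
-- only sees one-part compositions, that coefficient is [|α| = a] ν_Q(X_α).  Finally ζ̄_Q ν_Q = ζ_Q
-- becomes ζ̄_Q(X_·) ⋆ ν_Q(X_·) = f, which determines ν_Q(X_·) because f(∅) = 1, and
-- α ↦ [α odd] 2^ℓ(α) f(α) solves the same equation: the even parts in front contribute the factor
-- f_E, and on the odd parts the equation is the coefficient identity e^{-x} e^{2x} = e^x.
module Submission where

open import Algebra.Bundles using (CommutativeRing)
open import Data.Bool using (Bool; true; false; if_then_else_; not; _∧_; T; T?)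
open import Data.Bool.Properties using (∧-zeroʳ; ∧-identityʳ)
open import Data.Empty using (⊥-elim)
import Data.Fin as Fin
import Data.Fin.Properties as Fin
open import Data.List using (List; []; _∷_; [_]; _++_; map; concatMap; foldr; length)
import Data.List.Properties as List
open import Data.List.NonEmpty as List⁺ using (List⁺; _∷_)
open import Data.List.Relation.Unary.All using (All; []; _∷_)
open import Data.List.Relation.Unary.All.Properties using (++⁺)
open import Data.Nat as ℕ using (ℕ; zero; suc; _≤_; z≤n; s≤s; _≟_; _!; _^_; _∸_)
import Data.Nat.Combinatorics as ℕ
import Data.Nat.DivMod as ℕ
open import Data.Nat.Induction using (<-rec)
import Data.Nat.Properties as ℕ
open import Data.Product as Product using (_×_; _,_; proj₁; proj₂)
open import Data.Sum using (_⊎_; inj₁; inj₂)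
open import Data.Unit using (tt)
open import Function using (_∘_; case_of_)
open import Relation.Nullary using (¬_; Dec; yes; no)
open import Relation.Nullary.Decidable using (⌊_⌋; isYes≗does)
open import Relation.Binary.PropositionalEquality as ≡ using (_≡_)

open import Defs

≟C-∷ : ∀ a b (γ δ : Comp) → ⌊ (b ∷ γ) ≟C (a ∷ δ) ⌋ ≡ ⌊ b ≟⁺ a ⌋ ∧ ⌊ γ ≟C δ ⌋
≟C-∷ a b γ δ = ≡.trans (isYes≗does ((b ∷ γ) ≟C (a ∷ δ)))
  (≡.cong₂ _∧_ (≡.sym (isYes≗does (b ≟⁺ a))) (≡.sym (isYes≗does (γ ≟C δ))))

≟C-≡ : ∀ {γ δ} → γ ≡ δ → ⌊ γ ≟C δ ⌋ ≡ true
≟C-≡ {γ} {δ} γ≡δ with γ ≟C δ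
... | yes _   = ≡.refl
... | no γ≢δ = ⊥-elim (γ≢δ γ≡δ)

≟C-≢ : ∀ {γ δ} → ¬ γ ≡ δ → ⌊ γ ≟C δ ⌋ ≡ false
≟C-≢ {γ} {δ} γ≢δ with γ ≟C δ
... | yes γ≡δ = ⊥-elim (γ≢δ γ≡δ)
... | no _ = ≡.refl

val-⊕ : ∀ p q → val (p ⊕ q) ≡ val p ℕ.+ val q
val-⊕ (1+ x) (1+ y) = ≡.cong suc (≡.sym (ℕ.+-suc x y))

size-++ : ∀ p s → size (p ++ s) ≡ size p ℕ.+ size s
size-++ []      s = ≡.refl
size-++ (x ∷ p) s = ≡.trans (≡.cong (val x ℕ.+_) (size-++ p s)) (≡.sym (ℕ.+-assoc (val x) _ _))

val-blockSum : ∀ b → val (blockSum b) ≡ size (List⁺.toList b)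
val-blockSum (a ∷ α) = go a α
  where
  go : ∀ a α → val (blockSum (a ∷ α)) ≡ size (a ∷ α)
  go a []      = ≡.sym (ℕ.+-identityʳ (val a))
  go a (b ∷ α) = ≡.trans (val-⊕ a (blockSum (b ∷ α))) (≡.cong (val a ℕ.+_) (go b α))

≟⁺-val : ∀ p q → ⌊ p ≟⁺ q ⌋ ≡ ⌊ val p ℕ.≟ val q ⌋
≟⁺-val (1+ x) (1+ y) = ≡.trans (isYes≗does (1+ x ≟⁺ 1+ y)) (≡.sym (isYes≗does (suc x ℕ.≟ suc y)))

val-injective : ∀ {p q} → val p ≡ val q → p ≡ q
val-injective {1+ x} {1+ .x} ≡.refl = ≡.refl

isOddComp-∷-even : ∀ a α → isEvenPart a ≡ true → isOddComp (a ∷ α) ≡ false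
isOddComp-∷-even a α even with isEvenPart a
isOddComp-∷-even a α ≡.refl | .true = ≡.refl

isOddComp-∷-odd : ∀ a α → isEvenPart a ≡ false → isOddComp (a ∷ α) ≡ isOddComp α
isOddComp-∷-odd a α odd with isEvenPart a
isOddComp-∷-odd a α ≡.refl | .false = ≡.refl

isOddComp-++ : ∀ p s → isOddComp (p ++ s) ≡ isOddComp p ∧ isOddComp s
isOddComp-++ []      s = ≡.refl
isOddComp-++ (a ∷ p) s with isOddPart a
... | true  = isOddComp-++ p s
... | false = ≡.refl

module _ (a : ℕ⁺) (p : Comp) where

  restrictE-∷-even : isEvenPart a ≡ true → restrictE (a ∷ p) ≡ a ∷ restrictE p
  restrictE-∷-even even = List.filter-accept (T? ∘ isEvenPart) {a} {p} (≡.subst T (≡.sym even) tt)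

  restrictE-∷-odd : isEvenPart a ≡ false → restrictE (a ∷ p) ≡ restrictE p
  restrictE-∷-odd odd = List.filter-reject (T? ∘ isEvenPart) {a} {p} (≡.subst T odd)

  restrictO-∷-even : isEvenPart a ≡ true → restrictO (a ∷ p) ≡ restrictO p
  restrictO-∷-even even = List.filter-reject (T? ∘ isOddPart) {a} {p} (≡.subst (T ∘ not) even)

  restrictO-∷-odd : isEvenPart a ≡ false → restrictO (a ∷ p) ≡ a ∷ restrictO p
  restrictO-∷-odd odd = List.filter-accept (T? ∘ isOddPart) {a} {p} (≡.subst (T ∘ not) (≡.sym odd) tt)

parity : ∀ a → isEvenPart a ≡ true ⊎ isEvenPart a ≡ false
parity a with isEvenPart a
... | true  = inj₁ ≡.refl
... | false = inj₂ ≡.refl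

restrictE-odd : ∀ p → isOddComp p ≡ true → restrictE p ≡ []
restrictE-odd []      _   = ≡.refl
restrictE-odd (a ∷ p) odd with parity a
... | inj₁ even = case ≡.trans (≡.sym odd) (isOddComp-∷-even a p even) of λ ()
... | inj₂ odd-a = ≡.trans (restrictE-∷-odd a p odd-a)
                     (restrictE-odd p (≡.trans (≡.sym (isOddComp-∷-odd a p odd-a)) odd))

restrictO-odd : ∀ p → isOddComp p ≡ true → restrictO p ≡ p
restrictO-odd []      _   = ≡.refl
restrictO-odd (a ∷ p) odd with parity a
... | inj₁ even = case ≡.trans (≡.sym odd) (isOddComp-∷-even a p even) of λ ()
... | inj₂ odd-a = ≡.trans (restrictO-∷-odd a p odd-a)
                     (≡.cong (a ∷_) (restrictO-odd p (≡.trans (≡.sym (isOddComp-∷-odd a p odd-a)) odd)))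

isOddComp-restrictO : ∀ p → isOddComp (restrictO p) ≡ true
isOddComp-restrictO []      = ≡.refl
isOddComp-restrictO (a ∷ p) with parity a
... | inj₁ even = ≡.trans (≡.cong isOddComp (restrictO-∷-even a p even)) (isOddComp-restrictO p)
... | inj₂ odd  = ≡.trans (≡.cong isOddComp (restrictO-∷-odd a p odd))
                    (≡.trans (isOddComp-∷-odd a (restrictO p) odd) (isOddComp-restrictO p))

restrictE-head : ∀ p {x r} → restrictE p ≡ x ∷ r → isEvenPart x ≡ true
restrictE-head (a ∷ p) eq with parity a
... | inj₁ even with ≡.trans (≡.sym (restrictE-∷-even a p even)) eq
...   | ≡.refl = even
restrictE-head (a ∷ p) eq | inj₂ odd = restrictE-head p (≡.trans (≡.sym (restrictE-∷-odd a p odd)) eq)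

Even : ℕ⁺ → Set
Even a = isEvenPart a ≡ true

restrictE-evens : ∀ {e} → All Even e → restrictE e ≡ e
restrictE-evens []                     = ≡.refl
restrictE-evens {a ∷ e} (even ∷ evens) =
  ≡.trans (restrictE-∷-even a e even) (≡.cong (a ∷_) (restrictE-evens evens))

restrictO-evens : ∀ {e} → All Even e → restrictO e ≡ []
restrictO-evens []                     = ≡.refl
restrictO-evens {a ∷ e} (even ∷ evens) = ≡.trans (restrictO-∷-even a e even) (restrictO-evens evens)

restrictE-++ : ∀ p q → restrictE (p ++ q) ≡ restrictE p ++ restrictE q
restrictE-++ = List.filter-++ (T? ∘ isEvenPart)

restrictO-++ : ∀ p q → restrictO (p ++ q) ≡ restrictO p ++ restrictO q
restrictO-++ = List.filter-++ (T? ∘ isOddPart)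

sorted-oddHead : ∀ a p → isEvenPart a ≡ false →
                 a ∷ p ≡ restrictE (a ∷ p) ++ restrictO (a ∷ p) → restrictE (a ∷ p) ≡ []
sorted-oddHead a p odd sorted with restrictE (a ∷ p) in evens
... | []    = ≡.refl
... | x ∷ r with List.∷-injectiveˡ sorted
...   | ≡.refl = case ≡.trans (≡.sym odd) (restrictE-head (a ∷ p) evens) of λ ()

unsorted-oddHead-nonodd : ∀ a p → isEvenPart a ≡ false → isOddComp p ≡ false →
                          ¬ (a ∷ p ≡ restrictE (a ∷ p) ++ restrictO (a ∷ p))
unsorted-oddHead-nonodd a p odd nonodd sorted =
  case ≡.trans (≡.sym nonodd) (≡.trans (≡.sym (isOddComp-∷-odd a p odd)) odd-composition) of λ ()
  where
  odd-composition : isOddComp (a ∷ p) ≡ true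
  odd-composition = ≡.subst (λ q → isOddComp q ≡ true)
    (≡.sym (≡.trans sorted (≡.cong (_++ restrictO (a ∷ p)) (sorted-oddHead a p odd sorted))))
    (isOddComp-restrictO (a ∷ p))

Blocks : Set
Blocks = List (List⁺ ℕ⁺)

flatten : Blocks → Comp
flatten = concatMap List⁺.toList

size-blockSums : ∀ bs → size (map blockSum bs) ≡ size (flatten bs)
size-blockSums []       = ≡.refl
size-blockSums (b ∷ bs) = ≡.trans (≡.cong₂ ℕ._+_ (val-blockSum b) (size-blockSums bs))
                                  (≡.sym (size-++ (List⁺.toList b) (flatten bs)))

-- Finite sums over lists and convolution along deconcatenation

module ListSums {c ℓ} (R : CommutativeRing c ℓ) where
  open CommutativeRing R
  open import Algebra.Properties.Ring ring using (+-cancelʳ)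
  open import Algebra.Properties.CommutativeSemigroup +-commutativeSemigroup
    using (interchange)
  open import Algebra.Properties.CommutativeSemigroup *-commutativeSemigroup
    using () renaming (interchange to interchange-*)
  open import Algebra.Definitions.RawMonoid +-rawMonoid using (sum)
  open import Relation.Binary.Reasoning.Setoid setoid

  ∑ : ∀ {a} {A : Set a} → List A → (A → Carrier) → Carrier
  ∑ xs f = foldr _+_ 0# (map f xs)

  infix 5 ∑
  syntax ∑ xs (λ x → e) = ∑[ x ∈ xs ] e

  [_]·_ : Bool → Carrier → Carrier
  [ b ]· x = if b then x else 0#

  module _ {a} {A : Set a} where

    ∑-cong : {f g : A → Carrier} → (∀ x → f x ≈ g x) → ∀ xs → ∑ xs f ≈ ∑ xs g
    ∑-cong f≈g []       = refl
    ∑-cong f≈g (x ∷ xs) = +-cong (f≈g x) (∑-cong f≈g xs)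

    ∑-zero : {f : A → Carrier} → (∀ x → f x ≈ 0#) → ∀ xs → ∑ xs f ≈ 0#
    ∑-zero f≈0 []       = refl
    ∑-zero f≈0 (x ∷ xs) = trans (+-cong (f≈0 x) (∑-zero f≈0 xs)) (+-identityˡ 0#)

    ∑-++ : (f : A → Carrier) → ∀ xs ys → ∑ (xs ++ ys) f ≈ ∑ xs f + ∑ ys f
    ∑-++ f []       ys = sym (+-identityˡ _)
    ∑-++ f (x ∷ xs) ys = trans (+-cong refl (∑-++ f xs ys)) (sym (+-assoc _ _ _))

    ∑-+ : (f g : A → Carrier) → ∀ xs → ∑[ x ∈ xs ] (f x + g x) ≈ ∑ xs f + ∑ xs g
    ∑-+ f g []       = sym (+-identityˡ 0#)
    ∑-+ f g (x ∷ xs) = trans (+-cong refl (∑-+ f g xs)) (interchange _ _ _ _)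

    ∑-*ˡ : ∀ k (f : A → Carrier) xs → ∑[ x ∈ xs ] (k * f x) ≈ k * ∑ xs f
    ∑-*ˡ k f []       = sym (zeroʳ k)
    ∑-*ˡ k f (x ∷ xs) = trans (+-cong refl (∑-*ˡ k f xs)) (sym (distribˡ k _ _))

    ∑-*ʳ : ∀ k (f : A → Carrier) xs → ∑[ x ∈ xs ] (f x * k) ≈ ∑ xs f * k
    ∑-*ʳ k f xs = trans (∑-cong (λ x → *-comm (f x) k) xs) (trans (∑-*ˡ k f xs) (*-comm k _))

    ∑-guard : ∀ b (f : A → Carrier) xs → [ b ]· ∑ xs f ≈ ∑[ x ∈ xs ] [ b ]· f x
    ∑-guard true  f xs = refl
    ∑-guard false f xs = sym (∑-zero (λ _ → refl) xs)

  module _ {a b} {A : Set a} {B : Set b} where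

    ∑-map : (f : B → Carrier) (g : A → B) → ∀ xs → ∑ (map g xs) f ≈ ∑[ x ∈ xs ] f (g x)
    ∑-map f g []       = refl
    ∑-map f g (x ∷ xs) = +-cong refl (∑-map f g xs)

    ∑-concatMap : (f : B → Carrier) (g : A → List B) → ∀ xs →
                  ∑ (concatMap g xs) f ≈ ∑[ x ∈ xs ] ∑ (g x) f
    ∑-concatMap f g []       = refl
    ∑-concatMap f g (x ∷ xs) = trans (∑-++ f (g x) (concatMap g xs)) (+-cong refl (∑-concatMap f g xs))

  guard-*ˡ : ∀ b x y → x * [ b ]· y ≈ [ b ]· (x * y)
  guard-*ˡ true  x y = refl
  guard-*ˡ false x y = zeroʳ x

  guard-∧-* : ∀ b b′ x y → [ b ∧ b′ ]· (x * y) ≈ [ b ]· x * [ b′ ]· y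
  guard-∧-* true  true  x y = refl
  guard-∧-* true  false x y = sym (zeroʳ x)
  guard-∧-* false b′    x y = sym (zeroˡ _)

  guard-cong : ∀ b {x y} → x ≈ y → [ b ]· x ≈ [ b ]· y
  guard-cong true  x≈y = x≈y
  guard-cong false x≈y = refl

  module _ {a} {A : Set a} where

    deconcat : List A → List (List A × List A)
    deconcat []       = ([] , []) ∷ []
    deconcat (x ∷ xs) = ([] , x ∷ xs) ∷ map (Product.map₁ (x ∷_)) (deconcat xs)

    infixl 7 _⋆_

    _⋆_ : (List A → Carrier) → (List A → Carrier) → List A → Carrier
    (f ⋆ g) xs = ∑[ ps ∈ deconcat xs ] f (proj₁ ps) * g (proj₂ ps)

    ∑-deconcat-cong : ∀ {F G : List A × List A → Carrier} xs →
                      (∀ p s → p ++ s ≡ xs → F (p , s) ≈ G (p , s)) →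
                      ∑ (deconcat xs) F ≈ ∑ (deconcat xs) G
    ∑-deconcat-cong []       F≈G = +-cong (F≈G [] [] ≡.refl) refl
    ∑-deconcat-cong {F} {G} (x ∷ xs) F≈G = +-cong (F≈G [] (x ∷ xs) ≡.refl) (begin
      ∑ (map (Product.map₁ (x ∷_)) (deconcat xs)) F ≈⟨ ∑-map F _ (deconcat xs) ⟩
      ∑[ ps ∈ deconcat xs ] F (x ∷ proj₁ ps , proj₂ ps)
        ≈⟨ ∑-deconcat-cong xs (λ p s eq → F≈G (x ∷ p) s (≡.cong (x ∷_) eq)) ⟩
      ∑[ ps ∈ deconcat xs ] G (x ∷ proj₁ ps , proj₂ ps) ≈⟨ ∑-map G _ (deconcat xs) ⟨
      ∑ (map (Product.map₁ (x ∷_)) (deconcat xs)) G ∎)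

    ⋆-cons : ∀ f g x xs → (f ⋆ g) (x ∷ xs) ≈ f [] * g (x ∷ xs) + ((λ p → f (x ∷ p)) ⋆ g) xs
    ⋆-cons f g x xs = +-cong refl (∑-map (λ ps → f (proj₁ ps) * g (proj₂ ps)) _ (deconcat xs))

    ⋆-cong : ∀ {f f′ g g′} → (∀ p → f p ≈ f′ p) → (∀ s → g s ≈ g′ s) → ∀ xs → (f ⋆ g) xs ≈ (f′ ⋆ g′) xs
    ⋆-cong f≈f′ g≈g′ xs = ∑-cong (λ ps → *-cong (f≈f′ (proj₁ ps)) (g≈g′ (proj₂ ps))) (deconcat xs)

    ⋆-+ˡ : ∀ f f′ g xs → ((λ p → f p + f′ p) ⋆ g) xs ≈ (f ⋆ g) xs + (f′ ⋆ g) xs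
    ⋆-+ˡ f f′ g xs = trans (∑-cong (λ ps → distribʳ (g (proj₂ ps)) (f (proj₁ ps)) (f′ (proj₁ ps))) (deconcat xs))
                           (∑-+ _ _ (deconcat xs))

    ⋆-*ˡ : ∀ k f g xs → ((λ p → k * f p) ⋆ g) xs ≈ k * (f ⋆ g) xs
    ⋆-*ˡ k f g xs = trans (∑-cong (λ ps → *-assoc k _ _) (deconcat xs)) (∑-*ˡ k _ (deconcat xs))

    ⋆-weighted : ∀ (χ f g : List A → Carrier) → (∀ p s → χ (p ++ s) ≈ χ p * χ s) →
                 ∀ xs → ((λ p → χ p * f p) ⋆ (λ s → χ s * g s)) xs ≈ χ xs * (f ⋆ g) xs
    ⋆-weighted χ f g χ-++ xs = trans (∑-deconcat-cong xs factor) (∑-*ˡ (χ xs) _ (deconcat xs))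
      where
      factor : ∀ p s → p ++ s ≡ xs → (χ p * f p) * (χ s * g s) ≈ χ xs * (f p * g s)
      factor p s ≡.refl = trans (interchange-* _ _ _ _) (*-cong (sym (χ-++ p s)) refl)

    ⋆-head : ∀ f g xs → (∀ y p → f (y ∷ p) ≈ 0#) → (f ⋆ g) xs ≈ f [] * g xs
    ⋆-head f g []       f∷≈0 = +-identityʳ _
    ⋆-head f g (y ∷ ys) f∷≈0 = begin
      (f ⋆ g) (y ∷ ys)                                 ≈⟨ ⋆-cons f g y ys ⟩
      f [] * g (y ∷ ys) + ((λ p → f (y ∷ p)) ⋆ g) ys   ≈⟨ +-cong refl (∑-zero vanish (deconcat ys)) ⟩
      f [] * g (y ∷ ys) + 0#                           ≈⟨ +-identityʳ _ ⟩
      f [] * g (y ∷ ys)                                ∎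
      where
      vanish : ∀ ps → f (y ∷ proj₁ ps) * g (proj₂ ps) ≈ 0#
      vanish ps = trans (*-cong (f∷≈0 y (proj₁ ps)) refl) (zeroˡ _)

    ⋆-single : ∀ f g x xs → f [] ≈ 0# → (∀ y z p → f (y ∷ z ∷ p) ≈ 0#) →
               (f ⋆ g) (x ∷ xs) ≈ f (x ∷ []) * g xs
    ⋆-single f g x xs f[]≈0 f₂≈0 = begin
      (f ⋆ g) (x ∷ xs)                                  ≈⟨ ⋆-cons f g x xs ⟩
      f [] * g (x ∷ xs) + ((λ p → f (x ∷ p)) ⋆ g) xs    ≈⟨ +-cong (trans (*-cong f[]≈0 refl) (zeroˡ _)) refl ⟩
      0# + ((λ p → f (x ∷ p)) ⋆ g) xs                   ≈⟨ +-identityˡ _ ⟩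
      ((λ p → f (x ∷ p)) ⋆ g) xs                        ≈⟨ ⋆-head _ g xs (f₂≈0 x) ⟩
      f (x ∷ []) * g xs                                 ∎

    -- h [] is a unit, and every other prefix leaves a strictly shorter suffix.
    ⋆-cancelˡ : ∀ h u v → h [] ≈ 1# → (∀ xs → (h ⋆ u) xs ≈ (h ⋆ v) xs) → ∀ xs → u xs ≈ v xs
    ⋆-cancelˡ h u v h[]≈1 h⋆u≈h⋆v xs = <-rec P step (length xs) xs ≡.refl
      where
      P : ℕ → Set _
      P n = ∀ xs → length xs ≡ n → u xs ≈ v xs

      cancel-unit : ∀ {a b r} → h [] * a + r ≈ h [] * b + r → a ≈ b
      cancel-unit {a} {b} {r} eq = begin
        a           ≈⟨ *-identityˡ a ⟨
        1# * a      ≈⟨ *-cong h[]≈1 refl ⟨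
        h [] * a    ≈⟨ +-cancelʳ r _ _ eq ⟩
        h [] * b    ≈⟨ *-cong h[]≈1 refl ⟩
        1# * b      ≈⟨ *-identityˡ b ⟩
        b           ∎

      step : ∀ n → (∀ {m} → m ℕ.< n → P m) → P n
      step n ih [] _ = cancel-unit (h⋆u≈h⋆v [])
      step n ih (x ∷ xs) ≡.refl = cancel-unit (begin
        h [] * u (x ∷ xs) + ((λ p → h (x ∷ p)) ⋆ u) xs  ≈⟨ ⋆-cons h u x xs ⟨
        (h ⋆ u) (x ∷ xs)                                ≈⟨ h⋆u≈h⋆v (x ∷ xs) ⟩
        (h ⋆ v) (x ∷ xs)                                ≈⟨ ⋆-cons h v x xs ⟩
        h [] * v (x ∷ xs) + ((λ p → h (x ∷ p)) ⋆ v) xs  ≈⟨ +-cong refl tails ⟨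
        h [] * v (x ∷ xs) + ((λ p → h (x ∷ p)) ⋆ u) xs  ∎)
        where
        shorter : ∀ p s → p ++ s ≡ xs → length s ℕ.< length (x ∷ xs)
        shorter p s ≡.refl = s≤s (≡.subst (length s ≤_) (≡.sym (List.length-++ p)) (ℕ.m≤n+m _ _))
        tails : ((λ p → h (x ∷ p)) ⋆ u) xs ≈ ((λ p → h (x ∷ p)) ⋆ v) xs
        tails = ∑-deconcat-cong xs (λ p s eq → *-cong refl (ih (shorter p s eq) s ≡.refl))

  ∑-deconcat-length : ∀ {a} {A : Set a} (F : ℕ → ℕ → Carrier) (xs : List A) →
    ∑[ ps ∈ deconcat xs ] F (length (proj₁ ps)) (length (proj₂ ps)) ≈
    sum {suc (length xs)} (λ k → F (Fin.toℕ k) (length xs ℕ.∸ Fin.toℕ k))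
  ∑-deconcat-length F []       = refl
  ∑-deconcat-length F (x ∷ xs) =
    +-cong refl (trans (∑-map _ _ (deconcat xs)) (∑-deconcat-length (λ j l → F (suc j) l) xs))

  deconcat-map : ∀ {a b} {A : Set a} {B : Set b} (g : A → B) xs →
                 deconcat (map g xs) ≡ map (Product.map (map g) (map g)) (deconcat xs)
  deconcat-map g []       = ≡.refl
  deconcat-map g (x ∷ xs) = ≡.cong (([] , g x ∷ map g xs) ∷_)
    (≡.trans (≡.cong (map _) (deconcat-map g xs))
             (≡.trans (≡.sym (List.map-∘ (deconcat xs))) (List.map-∘ (deconcat xs))))

module BlockSums {c ℓ} (R : CommutativeRing c ℓ) where
  open CommutativeRing R
  open ListSums R
  open import Algebra.Properties.CommutativeSemigroup +-commutativeSemigroup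
    using (interchange)
  open import Relation.Binary.Reasoning.Setoid setoid

  ∑blocks : (Blocks → Carrier) → Comp → Carrier
  ∑blocks H α = ∑ (blockDecomps α) H

  attach : ℕ⁺ → (Blocks → Carrier) → Blocks → Carrier
  attach a H []       = H ((a ∷ []) ∷ [])
  attach a H (b ∷ bs) = H ((a ∷ []) ∷ b ∷ bs) + H ((a List⁺.∷⁺ b) ∷ bs)

  ∑blocks-cons : ∀ H a α → ∑blocks H (a ∷ α) ≈ ∑blocks (attach a H) α
  ∑blocks-cons H a α = trans (∑-concatMap H _ (blockDecomps α)) (∑-cong extend≈attach (blockDecomps α))
    where
    extend≈attach : ∀ bs → _ ≈ attach a H bs
    extend≈attach []       = +-identityʳ _
    extend≈attach (b ∷ bs) = +-cong refl (+-identityʳ _)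

  attach-⋆ : ∀ a P Q bs → attach a (P ⋆ Q) bs ≈ P [] * attach a Q bs + (attach a P ⋆ Q) bs
  attach-⋆ a P Q []       = refl
  attach-⋆ a P Q (b ∷ bs) = begin
    (P ⋆ Q) (single ∷ b ∷ bs) + (P ⋆ Q) (joined ∷ bs)
      ≈⟨ +-cong (trans (⋆-cons P Q single (b ∷ bs)) (+-cong refl (⋆-cons _ Q b bs))) (⋆-cons P Q joined bs) ⟩
    (A + (C + D)) + (B + E)                       ≈⟨ interchange A (C + D) B E ⟩
    (A + B) + ((C + D) + E)                       ≈⟨ +-cong (sym (distribˡ (P []) _ _)) (+-assoc C D E) ⟩
    P [] * attach a Q (b ∷ bs) + (C + (D + E))    ≈⟨ +-cong refl (+-cong refl (⋆-+ˡ _ _ Q bs)) ⟨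
    P [] * attach a Q (b ∷ bs) + (C + ((λ p → attach a P (b ∷ p)) ⋆ Q) bs)
      ≈⟨ +-cong refl (⋆-cons (attach a P) Q b bs) ⟨
    P [] * attach a Q (b ∷ bs) + (attach a P ⋆ Q) (b ∷ bs) ∎
    where
    single = a ∷ []
    joined = a List⁺.∷⁺ b
    A = P [] * Q (single ∷ b ∷ bs)
    B = P [] * Q (joined ∷ bs)
    C = P (single ∷ []) * Q (b ∷ bs)
    D = ((λ p → P (single ∷ b ∷ p)) ⋆ Q) bs
    E = ((λ p → P (joined ∷ p)) ⋆ Q) bs

  ∑blocks-⋆ : ∀ P Q α → ∑blocks (P ⋆ Q) α ≈ (∑blocks P ⋆ ∑blocks Q) α
  ∑blocks-⋆ P Q []      = +-cong (trans (+-identityʳ _) (sym (*-cong (+-identityʳ _) (+-identityʳ _)))) refl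
  ∑blocks-⋆ P Q (a ∷ α) = begin
    ∑blocks (P ⋆ Q) (a ∷ α)                                  ≈⟨ ∑blocks-cons (P ⋆ Q) a α ⟩
    ∑blocks (attach a (P ⋆ Q)) α                             ≈⟨ ∑-cong (attach-⋆ a P Q) (blockDecomps α) ⟩
    ∑[ bs ∈ blockDecomps α ] (P [] * attach a Q bs + (attach a P ⋆ Q) bs) ≈⟨ ∑-+ _ _ (blockDecomps α) ⟩
    (∑[ bs ∈ blockDecomps α ] P [] * attach a Q bs) + ∑blocks (attach a P ⋆ Q) α
      ≈⟨ +-cong (∑-*ˡ (P []) (attach a Q) (blockDecomps α)) (∑blocks-⋆ (attach a P) Q α) ⟩
    P [] * ∑blocks (attach a Q) α + (∑blocks (attach a P) ⋆ ∑blocks Q) α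
      ≈⟨ +-cong (*-cong (+-identityʳ _) (∑blocks-cons Q a α)) (⋆-cong (λ p → ∑blocks-cons P a p) (λ _ → refl) α) ⟨
    ∑blocks P [] * ∑blocks Q (a ∷ α) + ((λ p → ∑blocks P (a ∷ p)) ⋆ ∑blocks Q) α
      ≈⟨ ⋆-cons (∑blocks P) (∑blocks Q) a α ⟨
    (∑blocks P ⋆ ∑blocks Q) (a ∷ α)                          ∎

  ∑blocks-one-block : ∀ H a α → (∀ b b′ bs → H (b ∷ b′ ∷ bs) ≈ 0#) → ∑blocks H (a ∷ α) ≈ H ((a ∷ α) ∷ [])
  ∑blocks-one-block H a []      H₂≈0 = trans (∑blocks-cons H a []) (+-identityʳ _)
  ∑blocks-one-block H a (b ∷ α) H₂≈0 = begin
    ∑blocks H (a ∷ b ∷ α)                              ≈⟨ ∑blocks-cons H a (b ∷ α) ⟩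
    ∑blocks (attach a H) (b ∷ α)                       ≈⟨ ∑blocks-one-block (attach a H) b α attach₂≈0 ⟩
    H ((a ∷ []) ∷ (b ∷ α) ∷ []) + H ((a ∷ b ∷ α) ∷ []) ≈⟨ +-cong (H₂≈0 _ _ _) refl ⟩
    0# + H ((a ∷ b ∷ α) ∷ [])                          ≈⟨ +-identityˡ _ ⟩
    H ((a ∷ b ∷ α) ∷ [])                               ∎
    where
    attach₂≈0 : ∀ b b′ bs → attach a H (b ∷ b′ ∷ bs) ≈ 0#
    attach₂≈0 b b′ bs = trans (+-cong (H₂≈0 _ _ _) (H₂≈0 _ _ _)) (+-identityˡ 0#)

  ∑blocks-cong : ∀ {H H′} α → (∀ bs → flatten bs ≡ α → H bs ≈ H′ bs) → ∑blocks H α ≈ ∑blocks H′ α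
  ∑blocks-cong []      H≈H′ = +-cong (H≈H′ [] ≡.refl) refl
  ∑blocks-cong {H} {H′} (a ∷ α) H≈H′ =
    trans (∑blocks-cons H a α) (trans (∑blocks-cong α attach≈) (sym (∑blocks-cons H′ a α)))
    where
    attach≈ : ∀ bs → flatten bs ≡ α → attach a H bs ≈ attach a H′ bs
    attach≈ []       eq = H≈H′ _ (≡.cong (a ∷_) eq)
    attach≈ (b ∷ bs) eq = +-cong (H≈H′ _ (≡.cong (a ∷_) eq)) (H≈H′ _ (≡.cong (a ∷_) eq))

module _ {c ℓ} (𝕜 : Field c ℓ) where
  open Field 𝕜
  open Over 𝕜
  open ListSums commutativeRing
  open BlockSums commutativeRing
  open import Algebra.Properties.Ring ring using (-‿distribˡ-*; -‿involutive; -1*x≈-x)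
  open import Algebra.Properties.Semiring.Mult semiring using (×1-homo-*; ×-assoc-*)
  open import Algebra.Properties.Monoid.Mult +-monoid using (×-congʳ)
  open import Algebra.Properties.Semiring.Sum semiring using (sum-cong-≋; *-distribˡ-sum)
  open import Algebra.Properties.Semiring.Exp semiring using (^-congˡ) renaming (_^_ to _^ᴿ_)
  open import Algebra.Properties.CommutativeSemiring.Binomial commutativeSemiring
    using (binomialExpansion; binomialTerm; theorem)
  open import Algebra.Properties.CommutativeSemigroup +-commutativeSemigroup using (x∙yz≈y∙xz)
  open import Algebra.Properties.CommutativeSemigroup *-commutativeSemigroup
    using () renaming (interchange to *-interchange; x∙yz≈y∙xz to *-x∙yz≈y∙xz)
  open import Algebra.Definitions.RawMonoid +-rawMonoid using (sum) renaming (_×_ to _×′_)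
  open import Relation.Binary.Reasoning.Setoid setoid

  M* : Comp → Comp → Carrier
  M* γ δ = [ ⌊ δ ≟C γ ⌋ ]· 1#

  coeff-linFun : ∀ x γ → coeff x γ ≈ linFun (M* γ) x
  coeff-linFun x γ = ∑-cong (λ e → sym (trans (guard-*ˡ ⌊ proj₂ e ≟C γ ⌋ (proj₁ e) 1#)
                                              (guard-cong ⌊ proj₂ e ≟C γ ⌋ (*-identityʳ _)))) x

  coeff-scale : ∀ a x γ → coeff (scale a x) γ ≈ a * coeff x γ
  coeff-scale a x γ = begin
    coeff (scale a x) γ                                 ≈⟨ ∑-map _ _ x ⟩
    ∑[ e ∈ x ] [ ⌊ proj₂ e ≟C γ ⌋ ]· (a * proj₁ e)
      ≈⟨ ∑-cong (λ e → guard-*ˡ ⌊ proj₂ e ≟C γ ⌋ a (proj₁ e)) x ⟨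
    ∑[ e ∈ x ] a * [ ⌊ proj₂ e ≟C γ ⌋ ]· proj₁ e        ≈⟨ ∑-*ˡ a _ x ⟩
    a * coeff x γ                                       ∎

  coeff-linExt : ∀ θ x γ → coeff (linExt θ x) γ ≈ linFun (λ δ → coeff (θ δ) γ) x
  coeff-linExt θ x γ = trans (∑-concatMap _ _ x) (∑-cong (λ e → coeff-scale (proj₁ e) (θ (proj₂ e)) γ) x)

  coeff-linExt-M : ∀ θ β γ → coeff (linExt θ (M β)) γ ≈ coeff (θ β) γ
  coeff-linExt-M θ β γ = trans (coeff-linExt θ (M β) γ) (trans (+-identityʳ _) (*-identityˡ _))

  without : Comp → QSym → QSym
  without δ []            = []
  without δ ((a , γ) ∷ x) = if ⌊ γ ≟C δ ⌋ then without δ x else (a , γ) ∷ without δ x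

  length-without : ∀ δ x → length (without δ x) ≤ length x
  length-without δ []            = z≤n
  length-without δ ((a , γ) ∷ x) with ⌊ γ ≟C δ ⌋
  ... | true  = ℕ.m≤n⇒m≤1+n (length-without δ x)
  ... | false = s≤s (length-without δ x)

  linFun-without : ∀ φ δ x → linFun φ x ≈ coeff x δ * φ δ + linFun φ (without δ x)
  linFun-without φ δ [] = sym (trans (+-identityʳ _) (zeroˡ _))
  linFun-without φ δ ((a , γ) ∷ x) with γ ≟C δ | linFun-without φ δ x
  ... | yes ≡.refl | ih = begin
    a * φ γ + linFun φ x                                ≈⟨ +-cong refl ih ⟩
    a * φ γ + (coeff x γ * φ γ + linFun φ (without γ x)) ≈⟨ +-assoc _ _ _ ⟨
    (a * φ γ + coeff x γ * φ γ) + linFun φ (without γ x) ≈⟨ +-cong (distribʳ (φ γ) a _) refl ⟨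
    (a + coeff x γ) * φ γ + linFun φ (without γ x)       ∎
  ... | no _ | ih = begin
    a * φ γ + linFun φ x                                 ≈⟨ +-cong refl ih ⟩
    a * φ γ + (coeff x δ * φ δ + linFun φ (without δ x))  ≈⟨ x∙yz≈y∙xz _ _ _ ⟩
    coeff x δ * φ δ + (a * φ γ + linFun φ (without δ x))  ≈⟨ +-cong (*-cong (+-identityˡ _) refl) refl ⟨
    (0# + coeff x δ) * φ δ + (a * φ γ + linFun φ (without δ x)) ∎

  coeff-without-self : ∀ δ x → coeff (without δ x) δ ≈ 0#
  coeff-without-self δ [] = refl
  coeff-without-self δ ((a , γ) ∷ x) with γ ≟C δ
  ... | yes _   = coeff-without-self δ x
  ... | no γ≢δ rewrite ≟C-≢ γ≢δ = trans (+-identityˡ _) (coeff-without-self δ x)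

  coeff-without-other : ∀ δ γ x → ¬ γ ≡ δ → coeff (without δ x) γ ≈ coeff x γ
  coeff-without-other δ γ [] _ = refl
  coeff-without-other δ γ ((a , β) ∷ x) γ≢δ with β ≟C δ
  ... | no _ = +-cong refl (coeff-without-other δ γ x γ≢δ)
  ... | yes ≡.refl with β ≟C γ
  ...   | yes ≡.refl = ⊥-elim (γ≢δ ≡.refl)
  ...   | no _ = trans (coeff-without-other δ γ x γ≢δ) (sym (+-identityˡ _))

  linFun-support : ∀ φ ψ x → (∀ δ → coeff x δ * φ δ ≈ coeff x δ * ψ δ) → linFun φ x ≈ linFun ψ x
  linFun-support φ ψ x = <-rec P step (length x) x ≡.refl
    where
    P : ℕ → Set _
    P n = ∀ x → length x ≡ n → (∀ δ → coeff x δ * φ δ ≈ coeff x δ * ψ δ) → linFun φ x ≈ linFun ψ x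
    step : ∀ n → (∀ {m} → m ℕ.< n → P m) → P n
    step n ih [] _ _ = refl
    step n ih x@((a , δ) ∷ x′) ≡.refl agree = begin
      linFun φ x                                   ≈⟨ linFun-without φ δ x ⟩
      coeff x δ * φ δ + linFun φ (without δ x)
        ≈⟨ +-cong (agree δ) (ih shorter (without δ x) ≡.refl agree′) ⟩
      coeff x δ * ψ δ + linFun ψ (without δ x)     ≈⟨ linFun-without ψ δ x ⟨
      linFun ψ x                                   ∎
      where
      shorter : length (without δ x) ℕ.< length x
      shorter rewrite ≟C-≡ {δ} ≡.refl = s≤s (length-without δ x′)
      agree′ : ∀ γ → coeff (without δ x) γ * φ γ ≈ coeff (without δ x) γ * ψ γ
      agree′ γ with γ ≟C δ
      ... | yes ≡.refl = trans (*-cong (coeff-without-self γ x) refl)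
                           (trans (zeroˡ _) (sym (trans (*-cong (coeff-without-self γ x) refl) (zeroˡ _))))
      ... | no γ≢δ = trans (*-cong (coeff-without-other δ γ x γ≢δ) refl)
                       (trans (agree γ) (*-cong (sym (coeff-without-other δ γ x γ≢δ)) refl))

  M*-single-long : ∀ a y z p → M* [ a ] (y ∷ z ∷ p) ≈ 0#
  M*-single-long a y z p rewrite ≟C-∷ a y (z ∷ p) [] | ∧-zeroʳ ⌊ y ≟⁺ a ⌋ = refl

  M*-cons : ∀ a δ γ → M* (a ∷ δ) γ ≈ (M* [ a ] ⋆ M* δ) γ
  M*-cons a δ []      = sym (trans (+-identityʳ _) (zeroˡ _))
  M*-cons a δ (b ∷ γ) = begin
    [ ⌊ (b ∷ γ) ≟C (a ∷ δ) ⌋ ]· 1#          ≡⟨ ≡.cong ([_]· 1#) (≟C-∷ a b γ δ) ⟩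
    [ ⌊ b ≟⁺ a ⌋ ∧ ⌊ γ ≟C δ ⌋ ]· 1#          ≈⟨ split ⌊ b ≟⁺ a ⌋ ⌊ γ ≟C δ ⌋ ⟩
    [ ⌊ b ≟⁺ a ⌋ ∧ true ]· 1# * M* δ γ      ≡⟨ ≡.cong (λ x → [ x ]· 1# * M* δ γ) (≟C-∷ a b [] []) ⟨
    M* [ a ] [ b ] * M* δ γ                 ≈⟨ ⋆-single (M* [ a ]) (M* δ) b γ refl (M*-single-long a) ⟨
    (M* [ a ] ⋆ M* δ) (b ∷ γ)               ∎
    where
    split : ∀ x y → [ x ∧ y ]· 1# ≈ [ x ∧ true ]· 1# * [ y ]· 1#
    split true  y = sym (*-identityˡ _)
    split false y = sym (zeroˡ _)

  decon≡deconcat : ∀ γ → decon γ ≡ deconcat γ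
  decon≡deconcat []      = ≡.refl
  decon≡deconcat (a ∷ γ) = ≡.cong (([] , a ∷ γ) ∷_) (≡.cong (map _) (decon≡deconcat γ))

  coeff₂-Δ : ∀ y β γ → coeff₂ (Δ y) β γ ≈ linFun (M* β ⋆ M* γ) y
  coeff₂-Δ y β γ = trans (∑-concatMap _ _ y) (∑-cong term y)
    where
    guards : ∀ x z a → [ x ]· [ z ]· a ≈ a * ([ x ]· 1# * [ z ]· 1#)
    guards true  true  a = sym (trans (*-cong refl (*-identityˡ 1#)) (*-identityʳ a))
    guards true  false a = sym (trans (*-cong refl (zeroʳ 1#)) (zeroʳ a))
    guards false z     a = sym (trans (*-cong refl (zeroˡ _)) (zeroʳ a))
    term : ∀ e → coeff₂ (map (λ ps → (proj₁ e , ps)) (decon (proj₂ e))) β γ ≈ proj₁ e * (M* β ⋆ M* γ) (proj₂ e)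
    term (a , δ) = begin
      coeff₂ (map (λ ps → (a , ps)) (decon δ)) β γ                        ≈⟨ ∑-map _ _ (decon δ) ⟩
      ∑[ ps ∈ decon δ ] [ ⌊ proj₁ ps ≟C β ⌋ ]· [ ⌊ proj₂ ps ≟C γ ⌋ ]· a
        ≡⟨ ≡.cong (λ ds → ∑ ds _) (decon≡deconcat δ) ⟩
      ∑[ ps ∈ deconcat δ ] [ ⌊ proj₁ ps ≟C β ⌋ ]· [ ⌊ proj₂ ps ≟C γ ⌋ ]· a
        ≈⟨ ∑-cong (λ ps → guards _ _ a) (deconcat δ) ⟩
      ∑[ ps ∈ deconcat δ ] a * (M* β (proj₁ ps) * M* γ (proj₂ ps))        ≈⟨ ∑-*ˡ a _ (deconcat δ) ⟩
      a * (M* β ⋆ M* γ) δ                                               ∎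

  coeff₂-linExt₂ : ∀ θ z β δ → coeff₂ (linExt₂ θ z) β δ ≈
                   ∑[ e ∈ z ] proj₁ e * (coeff (θ (proj₁ (proj₂ e))) β * coeff (θ (proj₂ (proj₂ e))) δ)
  coeff₂-linExt₂ θ z β δ = trans (∑-concatMap _ _ z) (∑-cong term z)
    where
    guards : ∀ x y a b d → [ x ]· [ y ]· (a * b * d) ≈ a * ([ x ]· b * [ y ]· d)
    guards true  true  a b d = *-assoc a b d
    guards true  false a b d = sym (trans (*-cong refl (zeroʳ b)) (zeroʳ a))
    guards false y     a b d = sym (trans (*-cong refl (zeroˡ _)) (zeroʳ a))
    images : Carrier × Comp × Comp → QSym⊗QSym
    images (a , p , s) =
      concatMap (λ bβ → map (λ dδ → (a * proj₁ bβ * proj₁ dδ , proj₂ bβ , proj₂ dδ)) (θ s)) (θ p)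
    term : ∀ e → coeff₂ (images e) β δ ≈
                 proj₁ e * (coeff (θ (proj₁ (proj₂ e))) β * coeff (θ (proj₂ (proj₂ e))) δ)
    term (a , p , s) = begin
      coeff₂ (images (a , p , s)) β δ                         ≈⟨ ∑-concatMap _ _ (θ p) ⟩
      ∑[ bβ ∈ θ p ] coeff₂ (map (λ dδ → (a * proj₁ bβ * proj₁ dδ , proj₂ bβ , proj₂ dδ)) (θ s)) β δ
        ≈⟨ ∑-cong (λ bβ → trans (∑-map _ _ (θ s)) (∑-cong (pull-out bβ) (θ s))) (θ p) ⟩
      ∑[ bβ ∈ θ p ] ∑[ dδ ∈ θ s ] a * ([ ⌊ proj₂ bβ ≟C β ⌋ ]· proj₁ bβ * [ ⌊ proj₂ dδ ≟C δ ⌋ ]· proj₁ dδ)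
        ≈⟨ ∑-cong (λ bβ → trans (∑-*ˡ a _ (θ s)) (*-cong refl (∑-*ˡ _ _ (θ s)))) (θ p) ⟩
      ∑[ bβ ∈ θ p ] a * ([ ⌊ proj₂ bβ ≟C β ⌋ ]· proj₁ bβ * coeff (θ s) δ)
        ≈⟨ trans (∑-*ˡ a _ (θ p)) (*-cong refl (∑-*ʳ _ _ (θ p))) ⟩
      a * (coeff (θ p) β * coeff (θ s) δ) ∎
      where
      pull-out : ∀ bβ dδ → [ ⌊ proj₂ bβ ≟C β ⌋ ]· [ ⌊ proj₂ dδ ≟C δ ⌋ ]· (a * proj₁ bβ * proj₁ dδ) ≈
                           a * ([ ⌊ proj₂ bβ ≟C β ⌋ ]· proj₁ bβ * [ ⌊ proj₂ dδ ≟C δ ⌋ ]· proj₁ dδ)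
      pull-out bβ dδ = guards ⌊ proj₂ bβ ≟C β ⌋ ⌊ proj₂ dδ ≟C δ ⌋ a (proj₁ bβ) (proj₁ dδ)

  coeff₂-linExt₂-Δ-M : ∀ θ γ β δ →
    coeff₂ (linExt₂ θ (Δ (M γ))) β δ ≈ ((λ p → coeff (θ p) β) ⋆ (λ s → coeff (θ s) δ)) γ
  coeff₂-linExt₂-Δ-M θ γ β δ = begin
    coeff₂ (linExt₂ θ (Δ (M γ))) β δ                          ≈⟨ coeff₂-linExt₂ θ (Δ (M γ)) β δ ⟩
    ∑ (map (λ ps → (1# , ps)) (decon γ) ++ []) term
      ≈⟨ trans (∑-++ term (map (λ ps → (1# , ps)) (decon γ)) []) (+-identityʳ _) ⟩
    ∑ (map (λ ps → (1# , ps)) (decon γ)) term                 ≈⟨ ∑-map term _ (decon γ) ⟩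
    ∑[ ps ∈ decon γ ] 1# * (coeff (θ (proj₁ ps)) β * coeff (θ (proj₂ ps)) δ)
      ≡⟨ ≡.cong (λ ds → ∑ ds _) (decon≡deconcat γ) ⟩
    ∑[ ps ∈ deconcat γ ] 1# * (coeff (θ (proj₁ ps)) β * coeff (θ (proj₂ ps)) δ)
      ≈⟨ ∑-cong (λ ps → *-identityˡ _) (deconcat γ) ⟩
    ((λ p → coeff (θ p) β) ⋆ (λ s → coeff (θ s) δ)) γ          ∎
    where
    term : Carrier × Comp × Comp → Carrier
    term e = proj₁ e * (coeff (θ (proj₁ (proj₂ e))) β * coeff (θ (proj₂ (proj₂ e))) δ)

  linFun-cong : ∀ {φ ψ} → (∀ γ → φ γ ≈ ψ γ) → ∀ x → linFun φ x ≈ linFun ψ x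
  linFun-cong φ≈ψ = ∑-cong (λ e → *-cong refl (φ≈ψ (proj₂ e)))

  pow-1# : ∀ n → pow 1# n ≈ 1#
  pow-1# zero    = refl
  pow-1# (suc n) = trans (*-identityˡ _) (pow-1# n)

  ζQ-single : ∀ b → ζQ [ b ] ≈ 1#
  ζQ-single b = trans (+-identityʳ _) (trans (*-identityʳ _) (pow-1# (val b)))

  ζQ-long : ∀ b b′ δ → ζQ (b ∷ b′ ∷ δ) ≈ 0#
  ζQ-long b b′ δ = trans (+-identityʳ _) (zeroʳ _)

  module _ {θ : Comp → QSym} (θ-hopf : IsGradedHopfMap θ) where
    open IsGradedHopfMap θ-hopf

    θ-[] : ∀ γ → coeff (θ γ) [] ≈ M* [] γ
    θ-[] []      = trans (sym (coeff-linExt-M θ [] [])) (trans (unit []) (+-identityʳ _))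
    θ-[] (a ∷ γ) = graded (a ∷ γ) [] (λ ())

    θ-cons : ∀ γ a δ → coeff (θ γ) (a ∷ δ) ≈ ((λ p → coeff (θ p) [ a ]) ⋆ (λ s → coeff (θ s) δ)) γ
    θ-cons γ a δ = begin
      coeff (θ γ) (a ∷ δ)                        ≈⟨ coeff-linExt-M θ γ (a ∷ δ) ⟨
      coeff Θγ (a ∷ δ)                           ≈⟨ coeff-linFun Θγ (a ∷ δ) ⟩
      linFun (M* (a ∷ δ)) Θγ                     ≈⟨ linFun-cong (M*-cons a δ) Θγ ⟩
      linFun (M* [ a ] ⋆ M* δ) Θγ                ≈⟨ coeff₂-Δ Θγ [ a ] δ ⟨
      coeff₂ (Δ Θγ) [ a ] δ                      ≈⟨ comult γ [ a ] δ ⟩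
      coeff₂ (linExt₂ θ (Δ (M γ))) [ a ] δ       ≈⟨ coeff₂-linExt₂-Δ-M θ γ [ a ] δ ⟩
      ((λ p → coeff (θ p) [ a ]) ⋆ (λ s → coeff (θ s) δ)) γ ∎
      where
      Θγ : QSym
      Θγ = linExt θ (M γ)

    -- Only the term M_{(|γ|)} of θ γ is seen by ζQ, since θ is graded and ζQ vanishes on
    -- compositions with two or more parts.
    θ-single : (∀ γ → linFun ζQ (θ γ) ≈ νQ γ) → ∀ γ a → coeff (θ γ) [ a ] ≈ [ ⌊ size γ ≟ val a ⌋ ]· νQ γ
    θ-single θ-ν γ a with size γ ≟ val a
    ... | no  |γ|≢a = graded γ [ a ] (λ eq → |γ|≢a (≡.trans (≡.sym eq) (ℕ.+-identityʳ (val a))))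
    ... | yes |γ|≡a = begin
      coeff (θ γ) [ a ]          ≈⟨ coeff-linFun (θ γ) [ a ] ⟩
      linFun (M* [ a ]) (θ γ)    ≈⟨ linFun-support ζQ _ (θ γ) agree ⟨
      linFun ζQ (θ γ)            ≈⟨ θ-ν γ ⟩
      νQ γ                       ∎
      where
      agree : ∀ δ → coeff (θ γ) δ * ζQ δ ≈ coeff (θ γ) δ * M* [ a ] δ
      agree δ with size δ ≟ size γ
      ... | no |δ|≢|γ| = trans (*-cong (graded γ δ |δ|≢|γ|) refl)
                          (trans (zeroˡ _) (sym (trans (*-cong (graded γ δ |δ|≢|γ|) refl) (zeroˡ _))))
      agree [] | yes 0≡|γ| with ≡.trans 0≡|γ| |γ|≡a
      ... | ()
      agree (b ∷ []) | yes |b|≡|γ|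
        with val-injective {b} {a} (≡.trans (≡.sym (ℕ.+-identityʳ (val b))) (≡.trans |b|≡|γ| |γ|≡a))
      ... | ≡.refl rewrite ≟C-≡ {[ b ]} ≡.refl = *-cong refl (ζQ-single b)
      agree (b ∷ b′ ∷ δ) | yes _ = *-cong refl (trans (ζQ-long b b′ δ) (sym (M*-single-long a b b′ δ)))

  conv≈⋆ : ∀ φ ψ γ → conv φ ψ γ ≈ (φ ⋆ ψ) γ
  conv≈⋆ φ ψ γ = reflexive (≡.cong (λ ds → ∑ ds (λ ps → φ (proj₁ ps) * ψ (proj₂ ps))) (decon≡deconcat γ))

  ζQbar-single : ∀ b → ζQbar [ b ] ≈ minus1^ (val b)
  ζQbar-single b =
    trans (*-cong (reflexive (≡.cong minus1^ (ℕ.+-identityʳ (val b)))) (ζQ-single b)) (*-identityʳ _)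

  ζQbar-long : ∀ b b′ δ → ζQbar (b ∷ b′ ∷ δ) ≈ 0#
  ζQbar-long b b′ δ = trans (*-cong refl (ζQ-long b b′ δ)) (zeroʳ _)

  -- ζQbar vanishes beyond one part, so the recursion for its inverse has a single term.
  convInv-ζQbar-cons : ∀ b p → convInv ζQbar (b ∷ p) ≈ - (minus1^ (val b) * convInv ζQbar p)
  convInv-ζQbar-cons b p = -‿cong (begin
    conv (λ q → ζQbar (b ∷ q)) (convInvAux (length p) ζQbar) p ≈⟨ conv≈⋆ _ _ p ⟩
    ((λ q → ζQbar (b ∷ q)) ⋆ convInvAux (length p) ζQbar) p ≈⟨ ⋆-head _ _ p (ζQbar-long b) ⟩
    ζQbar [ b ] * convInv ζQbar p                          ≈⟨ *-cong (ζQbar-single b) refl ⟩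
    minus1^ (val b) * convInv ζQbar p                      ∎)

  νQ-cons : ∀ b γ → νQ (b ∷ γ) ≈ ζQ (b ∷ γ) - minus1^ (val b) * νQ γ
  νQ-cons b γ = begin
    νQ (b ∷ γ)                                                   ≈⟨ conv≈⋆ _ _ (b ∷ γ) ⟩
    (convInv ζQbar ⋆ ζQ) (b ∷ γ)                                 ≈⟨ ⋆-cons _ _ b γ ⟩
    1# * ζQ (b ∷ γ) + ((λ p → convInv ζQbar (b ∷ p)) ⋆ ζQ) γ
      ≈⟨ +-cong (*-identityˡ _) (⋆-cong inv-cons (λ _ → refl) γ) ⟩
    ζQ (b ∷ γ) + ((λ p → - m * convInv ζQbar p) ⋆ ζQ) γ          ≈⟨ +-cong refl (⋆-*ˡ (- m) _ _ γ) ⟩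
    ζQ (b ∷ γ) + - m * (convInv ζQbar ⋆ ζQ) γ                    ≈⟨ +-cong refl (*-cong refl (conv≈⋆ _ _ γ)) ⟨
    ζQ (b ∷ γ) + - m * νQ γ                                      ≈⟨ +-cong refl (-‿distribˡ-* m _) ⟨
    ζQ (b ∷ γ) - m * νQ γ                                        ∎
    where
    m = minus1^ (val b)
    inv-cons : ∀ p → convInv ζQbar (b ∷ p) ≈ - m * convInv ζQbar p
    inv-cons p = trans (convInv-ζQbar-cons b p) (-‿distribˡ-* m _)

  ζQbar⋆νQ : ∀ γ → (ζQbar ⋆ νQ) γ ≈ ζQ γ
  ζQbar⋆νQ []      = trans (+-identityʳ _)
    (trans (*-cong (*-identityˡ 1#) (trans (+-identityʳ _) (*-identityˡ 1#))) (*-identityˡ 1#))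
  ζQbar⋆νQ (b ∷ γ) = begin
    (ζQbar ⋆ νQ) (b ∷ γ)                                         ≈⟨ ⋆-cons _ _ b γ ⟩
    (1# * 1#) * νQ (b ∷ γ) + ((λ p → ζQbar (b ∷ p)) ⋆ νQ) γ     ≈⟨ +-cong 1*1*ν≈ν (⋆-head _ _ γ (ζQbar-long b)) ⟩
    νQ (b ∷ γ) + ζQbar [ b ] * νQ γ                             ≈⟨ +-cong (νQ-cons b γ) (*-cong (ζQbar-single b) refl) ⟩
    (ζQ (b ∷ γ) - m * νQ γ) + m * νQ γ                          ≈⟨ +-assoc _ _ _ ⟩
    ζQ (b ∷ γ) + (- (m * νQ γ) + m * νQ γ)                      ≈⟨ +-cong refl (-‿inverseˡ _) ⟩
    ζQ (b ∷ γ) + 0#                                             ≈⟨ +-identityʳ _ ⟩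
    ζQ (b ∷ γ)                                                  ∎
    where
    m = minus1^ (val b)
    1*1*ν≈ν : (1# * 1#) * νQ (b ∷ γ) ≈ νQ (b ∷ γ)
    1*1*ν≈ν = trans (*-cong (*-identityˡ 1#) refl) (*-identityˡ _)

  ι≡×1 : ∀ n → ι n ≡ n ×′ 1#
  ι≡×1 zero    = ≡.refl
  ι≡×1 (suc n) = ≡.cong (1# +_) (ι≡×1 n)

  ι-* : ∀ m n → ι (m ℕ.* n) ≈ ι m * ι n
  ι-* m n rewrite ι≡×1 (m ℕ.* n) | ι≡×1 m | ι≡×1 n = ×1-homo-* m n

  ι-2^ : ∀ n → ι (2 ^ n) ≈ (1# + 1#) ^ᴿ n
  ι-2^ zero    = +-identityʳ 1#
  ι-2^ (suc n) = trans (ι-* 2 (2 ^ n)) (*-cong (+-cong refl (+-identityʳ 1#)) (ι-2^ n))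

  minus1^≈ : ∀ n → minus1^ n ≈ (- 1#) ^ᴿ n
  minus1^≈ zero    = refl
  minus1^≈ (suc n) = trans (-‿cong (minus1^≈ n)) (sym (-1*x≈-x _))

  minus1^-+ : ∀ m n → minus1^ (m ℕ.+ n) ≈ minus1^ m * minus1^ n
  minus1^-+ zero    n = sym (*-identityˡ _)
  minus1^-+ (suc m) n = trans (-‿cong (minus1^-+ m n)) (-‿distribˡ-* _ _)

  minus1^-evenᵇ : ∀ n → minus1^ n ≈ (if evenᵇ n then 1# else - 1#)
  minus1^-evenᵇ zero = refl
  minus1^-evenᵇ (suc n) with evenᵇ n | minus1^-evenᵇ n
  ... | true  | ih = -‿cong ih
  ... | false | ih = trans (-‿cong ih) (-‿involutive 1#)

  minus1^-even : ∀ a → isEvenPart a ≡ true → minus1^ (val a) ≈ 1#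
  minus1^-even a even = trans (minus1^-evenᵇ (val a)) (reflexive (≡.cong (if_then 1# else - 1#) even))

  minus1^-odd : ∀ a → isEvenPart a ≡ false → minus1^ (val a) ≈ - 1#
  minus1^-odd a odd = trans (minus1^-evenᵇ (val a)) (reflexive (≡.cong (if_then 1# else - 1#) odd))

  minus1^-size-odd : ∀ p → isOddComp p ≡ true → minus1^ (size p) ≈ minus1^ (length p)
  minus1^-size-odd []      _   = refl
  minus1^-size-odd (a ∷ p) odd with parity a
  ... | inj₁ even = case ≡.trans (≡.sym odd) (isOddComp-∷-even a p even) of λ ()
  ... | inj₂ odd-a = begin
    minus1^ (val a ℕ.+ size p)           ≈⟨ minus1^-+ (val a) (size p) ⟩
    minus1^ (val a) * minus1^ (size p)   ≈⟨ *-cong (minus1^-odd a odd-a) (minus1^-size-odd p odd-p) ⟩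
    - 1# * minus1^ (length p)            ≈⟨ -1*x≈-x _ ⟩
    minus1^ (suc (length p))             ∎
    where
    odd-p : isOddComp p ≡ true
    odd-p = ≡.trans (≡.sym (isOddComp-∷-odd a p odd-a)) odd

  invFact : ℕ → Carrier
  invFact n = (ι (n !)) ⁻¹

  invFact-0 : invFact 0 ≈ 1#
  invFact-0 = begin
    invFact 0              ≈⟨ *-identityˡ _ ⟨
    1# * invFact 0         ≈⟨ *-cong (+-identityʳ 1#) refl ⟨
    ι 1 * invFact 0        ≈⟨ ⁻¹-inverse (ι 1) (λ ι1≈0 → 1≉0 (trans (sym (+-identityʳ 1#)) ι1≈0)) ⟩
    1#                     ∎

  choose*factorials : ∀ n k → k ≤ n → (n ℕ.C k) ℕ.* (k ! ℕ.* (n ∸ k) !) ≡ n !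
  choose*factorials n k k≤n =
    ≡.trans (≡.cong (ℕ._* (k ! ℕ.* (n ∸ k) !)) (ℕ.nCk≡n!/k![n-k]! k≤n))
            (ℕ.m/n*n≡m {{ℕ._!*_!≢0 k (n ∸ k)}} (ℕ.k![n∸k]!∣n! k≤n))

  module _ (charZero : CharZero) where

    ι[n!]*invFact : ∀ n → ι (n !) * invFact n ≈ 1#
    ι[n!]*invFact n = ⁻¹-inverse _ (λ ι[n!]≈0 → charZero (ℕ.pred (n !))
      (trans (reflexive (≡.cong ι (ℕ.suc-pred (n !) {{ℕ._!≢0 n}}))) ι[n!]≈0))

    -- Coefficientwise, e^{-x} e^{2x} = e^x: multiplied by n!, the sum is the binomial
    -- expansion of (-1 + 2)^n.
    binomial-invFact : ∀ n → sum {suc n} (λ k → (invFact (Fin.toℕ k) * minus1^ (Fin.toℕ k)) *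
                                                  (ι (2 ^ (n ∸ Fin.toℕ k)) * invFact (n ∸ Fin.toℕ k)))
                             ≈ invFact n
    binomial-invFact n = begin
      S                       ≈⟨ *-identityˡ S ⟨
      1# * S                  ≈⟨ *-cong (trans (*-comm _ _) (ι[n!]*invFact n)) refl ⟨
      (invFact n * ι (n !)) * S ≈⟨ *-assoc _ _ _ ⟩
      invFact n * (ι (n !) * S) ≈⟨ *-cong refl n!*S≈1 ⟩
      invFact n * 1#          ≈⟨ *-identityʳ _ ⟩
      invFact n               ∎
      where
      term : Fin.Fin (suc n) → Carrier
      term k = (invFact (Fin.toℕ k) * minus1^ (Fin.toℕ k)) * (ι (2 ^ (n ∸ Fin.toℕ k)) * invFact (n ∸ Fin.toℕ k))
      S = sum term
      n!*term : ∀ k → ι (n !) * term k ≈ binomialTerm (- 1#) (1# + 1#) n k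
      n!*term k = begin
        ι (n !) * term k
          ≈⟨ *-cong (trans (reflexive (≡.cong ι (≡.sym (choose*factorials n j j≤n))))
                           (trans (ι-* (n ℕ.C j) _) (*-cong refl (ι-* (j !) (l !))))) refl ⟩
        (ι (n ℕ.C j) * (ι (j !) * ι (l !))) * ((invFact j * minus1^ j) * (ι (2 ^ l) * invFact l))
          ≈⟨ *-assoc _ _ _ ⟩
        ι (n ℕ.C j) * ((ι (j !) * ι (l !)) * ((invFact j * minus1^ j) * (ι (2 ^ l) * invFact l)))
          ≈⟨ *-cong refl (*-interchange _ _ _ _) ⟩
        ι (n ℕ.C j) * ((ι (j !) * (invFact j * minus1^ j)) * (ι (l !) * (ι (2 ^ l) * invFact l)))
          ≈⟨ *-cong refl (*-cong cancel-j! cancel-l!) ⟩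
        ι (n ℕ.C j) * (minus1^ j * ι (2 ^ l))
          ≈⟨ *-cong refl (*-cong (minus1^≈ j) (ι-2^ l)) ⟩
        ι (n ℕ.C j) * ((- 1#) ^ᴿ j * (1# + 1#) ^ᴿ l)
          ≈⟨ ×-as-ι (n ℕ.C j) _ ⟨
        binomialTerm (- 1#) (1# + 1#) n k ∎
        where
        j = Fin.toℕ k
        l = n ∸ j
        j≤n = Fin.toℕ≤pred[n] k
        cancel-j! : ι (j !) * (invFact j * minus1^ j) ≈ minus1^ j
        cancel-j! = trans (sym (*-assoc _ _ _)) (trans (*-cong (ι[n!]*invFact j) refl) (*-identityˡ _))
        cancel-l! : ι (l !) * (ι (2 ^ l) * invFact l) ≈ ι (2 ^ l)
        cancel-l! = trans (*-x∙yz≈y∙xz _ _ _) (trans (*-cong refl (ι[n!]*invFact l)) (*-identityʳ _))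
        ×-as-ι : ∀ m x → m ×′ x ≈ ι m * x
        ×-as-ι m x = trans (×-congʳ m (sym (*-identityˡ x)))
                           (trans (sym (×-assoc-* m 1# x)) (*-cong (reflexive (≡.sym (ι≡×1 m))) refl))
      n!*S≈1 : ι (n !) * S ≈ 1#
      n!*S≈1 = begin
        ι (n !) * S                                ≈⟨ *-distribˡ-sum (ι (n !)) term ⟩
        sum (λ k → ι (n !) * term k)               ≈⟨ sum-cong-≋ n!*term ⟩
        binomialExpansion (- 1#) (1# + 1#) n       ≈⟨ theorem n (- 1#) (1# + 1#) ⟨
        (- 1# + (1# + 1#)) ^ᴿ n
          ≈⟨ ^-congˡ n (trans (sym (+-assoc _ _ _)) (trans (+-cong (-‿inverseˡ 1#) refl) (+-identityˡ 1#))) ⟩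
        1# ^ᴿ n                                    ≈⟨ 1^n n ⟩
        1#                                         ∎
        where
        1^n : ∀ n → 1# ^ᴿ n ≈ 1#
        1^n zero    = refl
        1^n (suc n) = trans (*-identityˡ _) (1^n n)

  eigenvalue : Comp → Carrier
  eigenvalue α = [ isOddComp α ]· ι (2 ^ length α)

  eigenvalue-++ : ∀ p s → eigenvalue (p ++ s) ≈ eigenvalue p * eigenvalue s
  eigenvalue-++ p s rewrite isOddComp-++ p s | List.length-++ p {s} | ℕ.^-distribˡ-+-* 2 (length p) (length s) =
    trans (guard-cong (isOddComp p ∧ isOddComp s) (ι-* (2 ^ length p) (2 ^ length s))) (guard-∧-* _ _ _ _)

  eigenvalue-M*-[] : ∀ α → M* [] α ≈ eigenvalue α * M* [] α
  eigenvalue-M*-[] []      = sym (trans (*-cong (+-identityʳ 1#) refl) (*-identityˡ 1#))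
  eigenvalue-M*-[] (a ∷ α) = sym (zeroʳ _)

  module _ (fE : Comp → Carrier) where

    weight : Blocks → Carrier
    weight bs = prodK (map (λ b → fX fE (List⁺.toList b)) bs)

    -- atX F α = Σ_{β ≥ α} f(α,β) F β, the value at X_α of the functional M_β ↦ F β.
    atX : (Comp → Carrier) → Comp → Carrier
    atX F = ∑blocks (λ bs → weight bs * F (map blockSum bs))

    linFun-X : ∀ F α → linFun F (X fE α) ≈ atX F α
    linFun-X F α = ∑-map _ _ (blockDecomps α)

    atX-cong : ∀ {F G} → (∀ γ → F γ ≈ G γ) → ∀ α → atX F α ≈ atX G α
    atX-cong F≈G α = ∑-cong (λ bs → *-cong refl (F≈G (map blockSum bs))) (blockDecomps α)

    weight-++ : ∀ xs ys → weight (xs ++ ys) ≈ weight xs * weight ys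
    weight-++ []       ys = sym (*-identityˡ _)
    weight-++ (x ∷ xs) ys = trans (*-cong refl (weight-++ xs ys)) (sym (*-assoc _ _ _))

    atX-⋆ : ∀ F G α → atX (F ⋆ G) α ≈ (atX F ⋆ atX G) α
    atX-⋆ F G α = trans (∑-cong split (blockDecomps α)) (∑blocks-⋆ _ _ α)
      where
      F′ G′ : Blocks → Carrier
      F′ bs = weight bs * F (map blockSum bs)
      G′ bs = weight bs * G (map blockSum bs)
      split : ∀ bs → weight bs * (F ⋆ G) (map blockSum bs) ≈ (F′ ⋆ G′) bs
      split bs = begin
        weight bs * (F ⋆ G) (map blockSum bs)
          ≡⟨ ≡.cong (λ ds → weight bs * ∑ ds FG) (deconcat-map blockSum bs) ⟩
        weight bs * ∑ (map (Product.map (map blockSum) (map blockSum)) (deconcat bs)) FG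
          ≈⟨ *-cong refl (∑-map _ _ (deconcat bs)) ⟩
        weight bs * (∑[ ps ∈ deconcat bs ] F (map blockSum (proj₁ ps)) * G (map blockSum (proj₂ ps)))
          ≈⟨ ∑-*ˡ (weight bs) _ (deconcat bs) ⟨
        ∑[ ps ∈ deconcat bs ] weight bs * (F (map blockSum (proj₁ ps)) * G (map blockSum (proj₂ ps)))
          ≈⟨ ∑-deconcat-cong bs distribute ⟩
        (F′ ⋆ G′) bs ∎
        where
        FG : Comp × Comp → Carrier
        FG ps = F (proj₁ ps) * G (proj₂ ps)
        distribute : ∀ p s → p ++ s ≡ bs →
                     weight bs * (F (map blockSum p) * G (map blockSum s)) ≈ F′ p * G′ s
        distribute p s ≡.refl = trans (*-cong (weight-++ p s) refl) (*-interchange _ _ _ _)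

    atX-[] : ∀ F → atX F [] ≈ F []
    atX-[] F = trans (+-identityʳ _) (*-identityˡ _)

    atX-one-block : ∀ F a α → (∀ b b′ γ → F (b ∷ b′ ∷ γ) ≈ 0#) →
                    atX F (a ∷ α) ≈ fX fE (a ∷ α) * F [ blockSum (a ∷ α) ]
    atX-one-block F a α F₂≈0 =
      trans (∑blocks-one-block _ a α (λ _ _ _ → trans (*-cong refl (F₂≈0 _ _ _)) (zeroʳ _)))
            (*-cong (*-identityʳ _) refl)

    atX-homogeneous : ∀ F n α → atX (λ γ → [ ⌊ size γ ≟ n ⌋ ]· F γ) α ≈ [ ⌊ size α ≟ n ⌋ ]· atX F α
    atX-homogeneous F n α = trans (∑blocks-cong α guard-out) (sym (∑-guard _ _ (blockDecomps α)))
      where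
      guard-out : ∀ bs → flatten bs ≡ α →
                  weight bs * [ ⌊ size (map blockSum bs) ≟ n ⌋ ]· F (map blockSum bs) ≈
                  [ ⌊ size α ≟ n ⌋ ]· (weight bs * F (map blockSum bs))
      guard-out bs ≡.refl rewrite size-blockSums bs = guard-*ˡ _ _ _

    atX-M*-[] : ∀ α → atX (M* []) α ≈ M* [] α
    atX-M*-[] []      = atX-[] (M* [])
    atX-M*-[] (a ∷ α) = trans (atX-one-block (M* []) a α (λ _ _ _ → refl)) (zeroʳ _)

    atX-M*-single : ∀ a α → atX (M* [ a ]) α ≈ [ ⌊ size α ≟ val a ⌋ ]· fX fE α
    atX-M*-single a []      = atX-[] (M* [ a ])
    atX-M*-single a (b ∷ α) = begin
      atX (M* [ a ]) (b ∷ α)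
        ≈⟨ atX-one-block (M* [ a ]) b α (M*-single-long a) ⟩
      fX fE (b ∷ α) * M* [ a ] [ blockSum (b ∷ α) ]
        ≡⟨ ≡.cong (λ x → fX fE (b ∷ α) * [ x ]· 1#) same-size ⟩
      fX fE (b ∷ α) * [ ⌊ size (b ∷ α) ≟ val a ⌋ ]· 1#       ≈⟨ guard-*ˡ _ _ _ ⟩
      [ ⌊ size (b ∷ α) ≟ val a ⌋ ]· (fX fE (b ∷ α) * 1#)     ≈⟨ guard-cong _ (*-identityʳ _) ⟩
      [ ⌊ size (b ∷ α) ≟ val a ⌋ ]· fX fE (b ∷ α)            ∎
      where
      same-size : ⌊ [ blockSum (b ∷ α) ] ≟C [ a ] ⌋ ≡ ⌊ size (b ∷ α) ≟ val a ⌋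
      same-size = ≡.trans (≟C-∷ a _ [] []) (≡.trans (∧-identityʳ _) (≡.trans (≟⁺-val _ a)
                    (≡.cong (λ n → ⌊ n ≟ val a ⌋) (val-blockSum (b ∷ α)))))

    coeff-X : ∀ α δ → coeff (X fE α) δ ≈ atX (M* δ) α
    coeff-X α δ = trans (coeff-linFun (X fE α) δ) (linFun-X (M* δ) α)

    coeff-eigenRHS : ∀ α δ → coeff (eigenRHS fE α) δ ≈ eigenvalue α * coeff (X fE α) δ
    coeff-eigenRHS α δ with isOddComp α
    ... | true  = coeff-scale _ (X fE α) δ
    ... | false = sym (zeroˡ _)

    fX-unfold : ∀ p {E O} → restrictE p ≡ E → restrictO p ≡ O →
                fX fE p ≡ [ ⌊ p ≟C (E ++ O) ⌋ ]· (fE E * invFact (length O))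
    fX-unfold p ≡.refl ≡.refl = ≡.refl

    fX-oddHead-nonodd : ∀ a p → isEvenPart a ≡ false → isOddComp p ≡ false → fX fE (a ∷ p) ≈ 0#
    fX-oddHead-nonodd a p odd nonodd rewrite ≟C-≢ (unsorted-oddHead-nonodd a p odd nonodd) = refl

    module _ (fE-[] : fE [] ≈ 1#) where

      fX-odd : ∀ p → isOddComp p ≡ true → fX fE p ≈ invFact (length p)
      fX-odd p odd rewrite fX-unfold p (restrictE-odd p odd) (restrictO-odd p odd) | ≟C-≡ {p} ≡.refl =
        trans (*-cong fE-[] refl) (*-identityˡ _)

      fX-[] : fX fE [] ≈ 1#
      fX-[] = trans (fX-odd [] ≡.refl) invFact-0

      fX-oddHead : ∀ a p → isEvenPart a ≡ false →
                   fX fE (a ∷ p) ≈ [ isOddComp (a ∷ p) ]· invFact (length (a ∷ p))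
      fX-oddHead a p odd rewrite isOddComp-∷-odd a p odd with isOddComp p in parity-p
      ... | true  = fX-odd (a ∷ p) (≡.trans (isOddComp-∷-odd a p odd) parity-p)
      ... | false = fX-oddHead-nonodd a p odd parity-p

      fX-evens : ∀ {e} → All Even e → fX fE e ≈ fE e
      fX-evens {e} evens
        rewrite fX-unfold e (restrictE-evens evens) (restrictO-evens evens) | ≟C-≡ (≡.sym (List.++-identityʳ e)) =
        trans (*-cong refl invFact-0) (*-identityʳ _)

      fX-evens++oddHead : ∀ {e} a p → All Even e → isEvenPart a ≡ false →
                          fX fE (e ++ a ∷ p) ≈ fE e * fX fE (a ∷ p)
      fX-evens++oddHead {e} a p evens odd = by-shape (q ≟C (E ++ O))
        where
        q = a ∷ p
        E = restrictE q
        O = restrictO q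
        unfold : fX fE (e ++ q) ≡ [ ⌊ (e ++ q) ≟C ((e ++ E) ++ O) ⌋ ]· (fE (e ++ E) * invFact (length O))
        unfold = fX-unfold (e ++ q) (≡.trans (restrictE-++ e q) (≡.cong (_++ E) (restrictE-evens evens)))
                                    (≡.trans (restrictO-++ e q) (≡.cong (_++ O) (restrictO-evens evens)))
        by-shape : Dec (q ≡ E ++ O) → fX fE (e ++ q) ≈ fE e * fX fE q
        by-shape (yes sorted) = begin
          fX fE (e ++ q)                                          ≡⟨ unfold ⟩
          [ ⌊ (e ++ q) ≟C ((e ++ E) ++ O) ⌋ ]· (fE (e ++ E) * invFact (length O))
            ≡⟨ ≡.cong ([_]· (fE (e ++ E) * invFact (length O)))
                      (≟C-≡ (≡.trans (≡.cong (e ++_) sorted) (≡.sym (List.++-assoc e E O)))) ⟩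
          fE (e ++ E) * invFact (length O)
            ≡⟨ ≡.cong (λ E′ → fE (e ++ E′) * invFact (length O)) E≡[] ⟩
          fE (e ++ []) * invFact (length O)
            ≡⟨ ≡.cong (λ e′ → fE e′ * invFact (length O)) (List.++-identityʳ e) ⟩
          fE e * invFact (length O)
            ≈⟨ *-cong refl (trans (*-cong fE-E≈1 refl) (*-identityˡ _)) ⟨
          fE e * (fE E * invFact (length O))
            ≡⟨ ≡.cong (λ b → fE e * [ b ]· (fE E * invFact (length O))) (≟C-≡ sorted) ⟨
          fE e * fX fE q                                          ∎
          where
          E≡[] = sorted-oddHead a p odd sorted
          fE-E≈1 : fE E ≈ 1#
          fE-E≈1 = trans (reflexive (≡.cong fE E≡[])) fE-[]
        by-shape (no unsorted) = begin
          fX fE (e ++ q)                    ≡⟨ unfold ⟩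
          [ ⌊ (e ++ q) ≟C ((e ++ E) ++ O) ⌋ ]· (fE (e ++ E) * invFact (length O))
            ≡⟨ ≡.cong ([_]· (fE (e ++ E) * invFact (length O)))
                      (≟C-≢ (λ eq → unsorted (List.++-cancelˡ e q (E ++ O) (≡.trans eq (List.++-assoc e E O))))) ⟩
          0#                                ≈⟨ zeroʳ _ ⟨
          fE e * 0#
            ≡⟨ ≡.cong (λ b → fE e * [ b ]· (fE E * invFact (length O))) (≟C-≢ unsorted) ⟨
          fE e * fX fE q                    ∎

      -- ν_Q at X_α

      signedfX : Comp → Carrier
      signedfX p = fX fE p * minus1^ (size p)

      signedfX-oddHead : ∀ a p → isEvenPart a ≡ false →
        signedfX (a ∷ p) ≈ [ isOddComp (a ∷ p) ]· (invFact (length (a ∷ p)) * minus1^ (length (a ∷ p)))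
      signedfX-oddHead a p odd with isOddComp (a ∷ p) in parity-ap
      ... | true  = *-cong (fX-odd (a ∷ p) parity-ap) (minus1^-size-odd (a ∷ p) parity-ap)
      ... | false = trans (*-cong (fX-oddHead-nonodd a p odd nonodd) refl) (zeroˡ _)
        where
        nonodd : isOddComp p ≡ false
        nonodd = ≡.trans (≡.sym (isOddComp-∷-odd a p odd)) parity-ap

      signedfX-after : Comp → Comp → Carrier
      signedfX-after e p = fX fE (e ++ p) * minus1^ (size p)

      νX : Comp → Carrier
      νX s = eigenvalue s * fX fE s

      νX-guarded : ∀ s → νX s ≈ [ isOddComp s ]· (ι (2 ^ length s) * invFact (length s))
      νX-guarded s with isOddComp s in parity-s
      ... | true  = *-cong refl (fX-odd s parity-s)
      ... | false = zeroˡ _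

      νX-[] : νX [] ≈ 1#
      νX-[] = trans (*-cong (+-identityʳ 1#) fX-[]) (*-identityˡ 1#)

      νX-evenHead : ∀ a β → isEvenPart a ≡ true → νX (a ∷ β) ≈ 0#
      νX-evenHead a β even rewrite isOddComp-∷-even a β even = zeroˡ _

      atX-ζQ : ∀ α → atX ζQ α ≈ fX fE α
      atX-ζQ []      = trans (atX-[] ζQ) (sym fX-[])
      atX-ζQ (a ∷ α) = begin
        atX ζQ (a ∷ α)                                ≈⟨ atX-one-block ζQ a α ζQ-long ⟩
        fX fE (a ∷ α) * ζQ [ blockSum (a List⁺.∷ α) ] ≈⟨ *-cong refl (ζQ-single (blockSum (a List⁺.∷ α))) ⟩
        fX fE (a ∷ α) * 1#                            ≈⟨ *-identityʳ _ ⟩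
        fX fE (a ∷ α)                                 ∎

      atX-ζQbar : ∀ α → atX ζQbar α ≈ signedfX α
      atX-ζQbar []      = trans (atX-[] ζQbar) (trans (*-identityʳ 1#) (sym (trans (*-identityʳ _) fX-[])))
      atX-ζQbar (a ∷ α) = begin
        atX ζQbar (a ∷ α)                                ≈⟨ atX-one-block ζQbar a α ζQbar-long ⟩
        fX fE (a ∷ α) * ζQbar [ blockSum (a List⁺.∷ α) ]
          ≈⟨ *-cong refl (ζQbar-single (blockSum (a List⁺.∷ α))) ⟩
        fX fE (a ∷ α) * minus1^ (val (blockSum (a List⁺.∷ α)))
          ≡⟨ ≡.cong (λ n → fX fE (a ∷ α) * minus1^ n) (val-blockSum (a List⁺.∷ α)) ⟩
        signedfX (a ∷ α)                                 ∎

      module _ (charZero : CharZero) where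

        signedfX⋆νX-oddHead : ∀ a β → isEvenPart a ≡ false → (signedfX ⋆ νX) (a ∷ β) ≈ fX fE (a ∷ β)
        signedfX⋆νX-oddHead a β odd = begin
          (signedfX ⋆ νX) (a ∷ β)
            ≈⟨ ∑-deconcat-cong (a ∷ β) term ⟩
          ∑[ ps ∈ deconcat (a ∷ β) ] [ odd? ]· G (length (proj₁ ps)) (length (proj₂ ps))
            ≈⟨ ∑-guard odd? (λ ps → G (length (proj₁ ps)) (length (proj₂ ps))) (deconcat (a ∷ β)) ⟨
          [ odd? ]· (∑[ ps ∈ deconcat (a ∷ β) ] G (length (proj₁ ps)) (length (proj₂ ps)))
            ≈⟨ guard-cong odd? (trans (∑-deconcat-length G (a ∷ β)) (binomial-invFact charZero (length (a ∷ β)))) ⟩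
          [ odd? ]· invFact (length (a ∷ β))                                ≈⟨ fX-oddHead a β odd ⟨
          fX fE (a ∷ β)                                                       ∎
          where
          odd? = isOddComp (a ∷ β)
          G : ℕ → ℕ → Carrier
          G j l = (invFact j * minus1^ j) * (ι (2 ^ l) * invFact l)
          signedfX-prefix : ∀ p s → p ++ s ≡ a ∷ β →
                            signedfX p ≈ [ isOddComp p ]· (invFact (length p) * minus1^ (length p))
          signedfX-prefix []      s eq     = *-cong (fX-odd [] ≡.refl) refl
          signedfX-prefix (x ∷ p) s ≡.refl = signedfX-oddHead x p odd
          term : ∀ p s → p ++ s ≡ a ∷ β → signedfX p * νX s ≈ [ odd? ]· G (length p) (length s)
          term p s eq = begin
            signedfX p * νX s ≈⟨ *-cong (signedfX-prefix p s eq) (νX-guarded s) ⟩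
            [ isOddComp p ]· _ * [ isOddComp s ]· _ ≈⟨ guard-∧-* _ _ _ _ ⟨
            [ isOddComp p ∧ isOddComp s ]· G (length p) (length s)
              ≡⟨ ≡.cong ([_]· G (length p) (length s)) (≡.trans (≡.sym (isOddComp-++ p s)) (≡.cong isOddComp eq)) ⟩
            [ odd? ]· G (length p) (length s) ∎

        signedfX⋆νX-evens : ∀ {e} β → All Even e → (signedfX-after e ⋆ νX) β ≈ fX fE (e ++ β)
        signedfX⋆νX-evens []      evens = trans (+-identityʳ _) (trans (*-cong (*-identityʳ _) νX-[]) (*-identityʳ _))
        signedfX⋆νX-evens {e} (a ∷ β) evens with parity a
        ... | inj₁ even = begin
          (signedfX-after e ⋆ νX) (a ∷ β)                   ≈⟨ ⋆-cons _ νX a β ⟩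
          signedfX-after e [] * νX (a ∷ β) + ((λ p → signedfX-after e (a ∷ p)) ⋆ νX) β
            ≈⟨ +-cong (trans (*-cong refl (νX-evenHead a β even)) (zeroʳ _)) (⋆-cong shift (λ _ → refl) β) ⟩
          0# + (signedfX-after (e ++ [ a ]) ⋆ νX) β         ≈⟨ +-identityˡ _ ⟩
          (signedfX-after (e ++ [ a ]) ⋆ νX) β              ≈⟨ signedfX⋆νX-evens β (++⁺ evens (even ∷ [])) ⟩
          fX fE ((e ++ [ a ]) ++ β)                         ≡⟨ ≡.cong (fX fE) (List.++-assoc e [ a ] β) ⟩
          fX fE (e ++ a ∷ β)                                ∎
          where
          sign-a : ∀ p → minus1^ (val a ℕ.+ size p) ≈ minus1^ (size p)
          sign-a p = trans (minus1^-+ (val a) (size p)) (trans (*-cong (minus1^-even a even) refl) (*-identityˡ _))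
          shift : ∀ p → signedfX-after e (a ∷ p) ≈ signedfX-after (e ++ [ a ]) p
          shift p = *-cong (reflexive (≡.cong (fX fE) (≡.sym (List.++-assoc e [ a ] p)))) (sign-a p)
        ... | inj₂ odd = begin
          (signedfX-after e ⋆ νX) (a ∷ β)                   ≈⟨ ∑-deconcat-cong (a ∷ β) factor ⟩
          ∑[ ps ∈ deconcat (a ∷ β) ] fE e * (signedfX (proj₁ ps) * νX (proj₂ ps))
                                                            ≈⟨ ∑-*ˡ (fE e) _ (deconcat (a ∷ β)) ⟩
          fE e * (signedfX ⋆ νX) (a ∷ β)                    ≈⟨ *-cong refl (signedfX⋆νX-oddHead a β odd) ⟩
          fE e * fX fE (a ∷ β)                              ≈⟨ fX-evens++oddHead a β evens odd ⟨
          fX fE (e ++ a ∷ β)                                ∎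
          where
          evens++ : ∀ p s → p ++ s ≡ a ∷ β → fX fE (e ++ p) ≈ fE e * fX fE p
          evens++ []      s eq     = begin
            fX fE (e ++ [])     ≡⟨ ≡.cong (fX fE) (List.++-identityʳ e) ⟩
            fX fE e             ≈⟨ fX-evens evens ⟩
            fE e                ≈⟨ *-identityʳ _ ⟨
            fE e * 1#           ≈⟨ *-cong refl fX-[] ⟨
            fE e * fX fE []     ∎
          evens++ (x ∷ p) s ≡.refl = fX-evens++oddHead x p evens odd
          factor : ∀ p s → p ++ s ≡ a ∷ β → signedfX-after e p * νX s ≈ fE e * (signedfX p * νX s)
          factor p s eq = trans (*-cong (trans (*-cong (evens++ p s eq) refl) (*-assoc _ _ _)) refl) (*-assoc _ _ _)

        signedfX⋆νX : ∀ α → (signedfX ⋆ νX) α ≈ fX fE α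
        signedfX⋆νX α = signedfX⋆νX-evens α []

        atX-νQ : ∀ α → atX νQ α ≈ νX α
        atX-νQ = ⋆-cancelˡ signedfX (atX νQ) νX (trans (*-identityʳ _) fX-[]) (λ α → begin
          (signedfX ⋆ atX νQ) α    ≈⟨ ⋆-cong atX-ζQbar (λ _ → refl) α ⟨
          (atX ζQbar ⋆ atX νQ) α   ≈⟨ atX-⋆ ζQbar νQ α ⟨
          atX (ζQbar ⋆ νQ) α       ≈⟨ atX-cong ζQbar⋆νQ α ⟩
          atX ζQ α                 ≈⟨ atX-ζQ α ⟩
          fX fE α                  ≈⟨ signedfX⋆νX α ⟨
          (signedfX ⋆ νX) α        ∎)

        -- Θ on X_α

        module _ {θ : Comp → QSym} (θ-hopf : IsGradedHopfMap θ) (θ-ν : ∀ γ → linFun ζQ (θ γ) ≈ νQ γ) where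

          Θ-X-[] : ∀ α → atX (λ γ → coeff (θ γ) []) α ≈ eigenvalue α * atX (M* []) α
          Θ-X-[] α = begin
            atX (λ γ → coeff (θ γ) []) α   ≈⟨ atX-cong (θ-[] θ-hopf) α ⟩
            atX (M* []) α                  ≈⟨ atX-M*-[] α ⟩
            M* [] α                        ≈⟨ eigenvalue-M*-[] α ⟩
            eigenvalue α * M* [] α         ≈⟨ *-cong refl (atX-M*-[] α) ⟨
            eigenvalue α * atX (M* []) α   ∎

          Θ-X-single : ∀ a α → atX (λ γ → coeff (θ γ) [ a ]) α ≈ eigenvalue α * atX (M* [ a ]) α
          Θ-X-single a α = begin
            atX (λ γ → coeff (θ γ) [ a ]) α        ≈⟨ atX-cong (λ γ → θ-single θ-hopf θ-ν γ a) α ⟩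
            atX (λ γ → [ |·|≟a γ ]· νQ γ) α        ≈⟨ atX-homogeneous νQ (val a) α ⟩
            [ |·|≟a α ]· atX νQ α                  ≈⟨ guard-cong (|·|≟a α) (atX-νQ α) ⟩
            [ |·|≟a α ]· (eigenvalue α * fX fE α)  ≈⟨ guard-*ˡ (|·|≟a α) _ _ ⟨
            eigenvalue α * [ |·|≟a α ]· fX fE α    ≈⟨ *-cong refl (atX-M*-single a α) ⟨
            eigenvalue α * atX (M* [ a ]) α        ∎
            where
            |·|≟a : Comp → Bool
            |·|≟a γ = ⌊ size γ ≟ val a ⌋

          Θ-X : ∀ δ α → atX (λ γ → coeff (θ γ) δ) α ≈ eigenvalue α * atX (M* δ) α
          Θ-X []      α = Θ-X-[] α
          Θ-X (a ∷ δ) α = begin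
            atX (λ γ → coeff (θ γ) (a ∷ δ)) α
              ≈⟨ atX-cong (λ γ → θ-cons θ-hopf γ a δ) α ⟩
            atX ((λ p → coeff (θ p) [ a ]) ⋆ (λ s → coeff (θ s) δ)) α
              ≈⟨ atX-⋆ _ _ α ⟩
            (atX (λ p → coeff (θ p) [ a ]) ⋆ atX (λ s → coeff (θ s) δ)) α
              ≈⟨ ⋆-cong (Θ-X-single a) (Θ-X δ) α ⟩
            ((λ p → eigenvalue p * atX (M* [ a ]) p) ⋆ (λ s → eigenvalue s * atX (M* δ) s)) α
              ≈⟨ ⋆-weighted eigenvalue _ _ eigenvalue-++ α ⟩
            eigenvalue α * (atX (M* [ a ]) ⋆ atX (M* δ)) α
              ≈⟨ *-cong refl (atX-⋆ _ _ α) ⟨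
            eigenvalue α * atX (M* [ a ] ⋆ M* δ) α
              ≈⟨ *-cong refl (atX-cong (M*-cons a δ) α) ⟨
            eigenvalue α * atX (M* (a ∷ δ)) α ∎

theorem6p1 : ∀ {c ℓ} (𝕜 : Field c ℓ) → let open Over 𝕜 in
    CharZero →
    (fE : Comp → Field.Carrier 𝕜) → IsNonsingularShuffleChar fE →
    (θ : Comp → QSym) → IsGradedHopfMap θ →
    (∀ γ → Field._≈_ 𝕜 (linFun ζQ (θ γ)) (νQ γ)) →
    ∀ α → linExt θ (X fE α) ≃ eigenRHS fE α
theorem6p1 𝕜 charZero fE fE-shuffle θ θ-hopf θ-ν α δ = begin
  coeff (linExt θ (X fE α)) δ              ≈⟨ coeff-linExt 𝕜 θ (X fE α) δ ⟩
  linFun (λ γ → coeff (θ γ) δ) (X fE α)    ≈⟨ linFun-X 𝕜 fE _ α ⟩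
  atX 𝕜 fE (λ γ → coeff (θ γ) δ) α         ≈⟨ Θ-X 𝕜 fE fE-[] charZero θ-hopf θ-ν δ α ⟩
  eigenvalue 𝕜 α * atX 𝕜 fE (M* 𝕜 δ) α     ≈⟨ *-cong refl (coeff-X 𝕜 fE α δ) ⟨
  eigenvalue 𝕜 α * coeff (X fE α) δ        ≈⟨ coeff-eigenRHS 𝕜 fE α δ ⟨
  coeff (eigenRHS fE α) δ                  ∎
  where
  open Field 𝕜
  open Over 𝕜
  open import Relation.Binary.Reasoning.Setoid setoid
  fE-[] : fE [] ≈ 1#
  fE-[] = IsNonsingularShuffleChar.empty fE-shuffle
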